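{- Let $n\ge 10$ be an integer. In $\mathbb{Z}/n\mathbb{Z}$ let $A=\mathbb{Z}/n\mathbb{Z}\setminus\{0,1,3\}$ and $B=\mathbb{Z}/n\mathbb{Z}\setminus\{0,1,6\}$. Then the generating function $\sum_f c_0^{w_0(f)}c_1^{w_1(f)}c_3^{w_3(f)}$, where $f$ ranges over all matchings from $A$ to $B$, equals $$\sum_{\substack{w_0 + w_1 + w_3 = n-3 \\ 2w_0 + w_1 + 1 = w_3+6}} \left( \binom{w_0+w_1-2}{w_1} + \binom{w_0+w_1-3}{w_1-1} + \binom{w_0+w_1-3}{w_1-3} \right) c_0^{w_0} c_1^{w_1} c_3^{w_3},$$ the sum being over nonnegative integers $w_0,w_1,w_3$.
   Context: For an abelian group $(G,+)$ and nonempty finite subsets $A,B\subseteq G$, a matching from $A$ to $B$ is a bijection $f:A\to B$ such that $a+f(a)\notin A$ for all $a\in A$. Here $0,1,3,6$ denote residue classes modulo $n$, and for a matching $f$, $w_k(f)=|\{a\in A: a+f(a)=k\}|$ for $k\in\{0,1,3\}$; $c_0,c_1,c_3$ are commuting indeterminates. Binomial coefficients $\binom{a}{b}$ with integer $b<0$ are taken to be $0$, and for $b\ge 0$, $\binom{a}{b}=a(a-1)\cdots(a-b+1)/b!$. -}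

module Defs where

open import Data.Nat as ℕ using (ℕ; zero; suc; NonZero; _!; _∸_)
open import Data.Nat.Properties using (_!≢0)
open import Data.Nat.DivMod using (_mod_)
open import Data.Integer as ℤ using (ℤ; +_; _-_; _*_; _<_)
open import Data.Integer.DivMod using (_/_)
open import Data.Fin using (Fin; toℕ)
open import Data.Fin.Properties using (all?; any?) renaming (_≟_ to _≟ᶠ_)
open import Data.Vec using (Vec; lookup) renaming ([] to []ᵥ; _∷_ to _∷ᵥ_)
open import Data.List as List using (List; []; _∷_; allFin; filter; length; concatMap; map)
open import Data.Product using (_×_; ∃)
open import Relation.Binary.PropositionalEquality using (_≡_; _≢_)
open import Relation.Nullary using (¬_; Dec; yes; no)
open import Relation.Nullary.Decidable using (_×-dec_; ¬?; _→-dec_)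

module _ (n : ℕ) .{{_ : NonZero n}} where

  [_] : ℕ → Fin n
  [ k ] = k mod n

  _⊕_ : Fin n → Fin n → Fin n
  x ⊕ y = (toℕ x ℕ.+ toℕ y) mod n

  InA : Fin n → Set
  InA x = (x ≢ [ 0 ]) × (x ≢ [ 1 ]) × (x ≢ [ 3 ])

  InB : Fin n → Set
  InB x = (x ≢ [ 0 ]) × (x ≢ [ 1 ]) × (x ≢ [ 6 ])

  inA? : (x : Fin n) → Dec (InA x)
  inA? x = ¬? (x ≟ᶠ [ 0 ]) ×-dec ¬? (x ≟ᶠ [ 1 ]) ×-dec ¬? (x ≟ᶠ [ 3 ])

  inB? : (x : Fin n) → Dec (InB x)
  inB? x = ¬? (x ≟ᶠ [ 0 ]) ×-dec ¬? (x ≟ᶠ [ 1 ]) ×-dec ¬? (x ≟ᶠ [ 6 ])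

  -- A map f : A → B is encoded as a vector v : Vec (Fin n) n, with
  -- f a = lookup v a for a ∈ A.  To make the encoding one-to-one we
  -- normalise the (irrelevant) entries outside A: v[x] = x for x ∉ A.

  _at_ : Vec (Fin n) n → Fin n → Fin n
  v at x = lookup v x

  IsMatching : Vec (Fin n) n → Set
  IsMatching v =
      (∀ a → InA a → InB (v at a))
    × (∀ a → InA a → ∀ a' → InA a' → v at a ≡ v at a' → a ≡ a')
    × (∀ b → InB b → ∃ λ a → InA a × v at a ≡ b)
    × (∀ a → InA a → ¬ InA (a ⊕ (v at a)))
    × (∀ x → ¬ InA x → v at x ≡ x)

  isMatching? : (v : Vec (Fin n) n) → Dec (IsMatching v)
  isMatching? v =
        all? (λ a → inA? a →-dec inB? (v at a))
    ×-dec all? (λ a → inA? a →-dec all? (λ a' → inA? a' →-dec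
            ((v at a ≟ᶠ v at a') →-dec (a ≟ᶠ a'))))
    ×-dec all? (λ b → inB? b →-dec any? (λ a → inA? a ×-dec (v at a ≟ᶠ b)))
    ×-dec all? (λ a → inA? a →-dec ¬? (inA? (a ⊕ (v at a))))
    ×-dec all? (λ x → ¬? (inA? x) →-dec (v at x ≟ᶠ x))

  weight : Fin n → Vec (Fin n) n → ℕ
  weight k v = length (filter (λ a → inA? a ×-dec ((a ⊕ (v at a)) ≟ᶠ k)) (allFin n))

  allVecs : (m : ℕ) → List (Vec (Fin n) m)
  allVecs zero    = []ᵥ ∷ []
  allVecs (suc m) = concatMap (λ x → map (x ∷ᵥ_) (allVecs m)) (allFin n)

  HasWeights : ℕ → ℕ → ℕ → Vec (Fin n) n → Set
  HasWeights w₀ w₁ w₃ v =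
    (weight [ 0 ] v ≡ w₀) × (weight [ 1 ] v ≡ w₁) × (weight [ 3 ] v ≡ w₃)

  hasWeights? : ∀ w₀ w₁ w₃ v → Dec (HasWeights w₀ w₁ w₃ v)
  hasWeights? w₀ w₁ w₃ v =
    (weight [ 0 ] v ℕ.≟ w₀) ×-dec (weight [ 1 ] v ℕ.≟ w₁) ×-dec (weight [ 3 ] v ℕ.≟ w₃)

  -- Coefficient of c₀^w₀ c₁^w₁ c₃^w₃ in  Σ_f c₀^{w₀(f)} c₁^{w₁(f)} c₃^{w₃(f)}:
  -- the number of matchings f from A to B with (w₀(f),w₁(f),w₃(f)) = (w₀,w₁,w₃).
  matchingGF : ℕ → ℕ → ℕ → ℕ
  matchingGF w₀ w₁ w₃ =
    length (filter (λ v → isMatching? v ×-dec hasWeights? w₀ w₁ w₃ v) (allVecs n))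

falling : ℤ → ℕ → ℤ
falling a zero    = + 1
falling a (suc k) = a * falling (a - + 1) k

binomℕ : ℤ → ℕ → ℤ
binomℕ a k = (falling a k / + (k !)) {{k !≢0}}

binom : ℤ → ℤ → ℤ
binom a (+ k)      = binomℕ a k
binom a ℤ.-[1+ _ ] = + 0

rhsCoeff : ℕ → ℕ → ℕ → ℕ → ℤ
rhsCoeff n w₀ w₁ w₃ with (w₀ ℕ.+ w₁ ℕ.+ w₃) ℕ.≟ (n ∸ 3) | (2 ℕ.* w₀ ℕ.+ w₁ ℕ.+ 1) ℕ.≟ (w₃ ℕ.+ 6)
... | yes _ | yes _ =
        binom (+ w₀ ℤ.+ + w₁ - + 2) (+ w₁)
  ℤ.+ binom (+ w₀ ℤ.+ + w₁ - + 3) (+ w₁ - + 1)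
  ℤ.+ binom (+ w₀ ℤ.+ + w₁ - + 3) (+ w₁ - + 3)
... | _     | _     = + 0

-- A matching sends a ∈ A to f(a) with a + f(a) = n + d, where d ∈ {0, 1, 3}
-- is the weight of a (c₀, c₁ or c₃).  Reading the positions 0, 1, …, n − 1 in
-- order, injectivity and surjectivity only involve positions at distance at
-- most 3: f(a) = f(a′) forces a′ − a = d − d′ ∈ {1, 2, 3}, and the target
-- n + 3 − a can only be reached from a − 3, a − 2 and a.  So matchings are the
-- words accepted by an automaton whose state records which of the next three
-- targets are already covered, and their weighted count F(n) is given by the
-- transfer recursion tailGF.  Unrolling it three steps gives
--   F(n + 3) = c₁ c₃ F(n + 1) + c₀ c₃² F(n),
-- which the binomial sum also satisfies by Pascal's rule; the cases
-- n = 10, 11, 12 are checked by evaluation.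

module Submission where

open import Level using (0ℓ)
open import Data.Nat
open import Data.Nat.Properties
open import Data.Nat.Combinatorics using (_C_; _P_; nCk+nC[k+1]≡[n+1]C[k+1]; k>n⇒nCk≡0; k>n⇒nPk≡0; nCn≡1; nCk≡nPk/k!)
open import Data.Nat.Combinatorics.Base using (_P′_)
open import Data.Nat.Combinatorics.Specification using (nP′k≡n[n∸1P′k∸1])
open import Data.Nat.DivMod using (0/n≡0; m<n⇒m%n≡m; m≤n⇒[n∸m]%m≡n%m)
open import Data.Nat.ListAction using (sum)
open import Data.Nat.Tactic.RingSolver using (solve-∀)
import Data.Integer as ℤ
import Data.Integer.Properties as ℤ
open import Data.Integer.DivMod using (div-pos-is-/ℕ)
open import Data.Bool using (Bool; true; false; T; if_then_else_; _∧_; _∨_; not)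
open import Data.Bool.Properties
  using (if-eta; if-cong; T-≡; T-∧; T-∨; ¬-not; not-involutive; ∨-identityʳ; ∨-zeroʳ; ∧-identityʳ; ∧-zeroʳ; ∧-comm; ∧-assoc)
open import Data.Fin using (Fin; toℕ; fromℕ<) renaming (zero to fzero; suc to fsuc)
open import Data.Fin.Properties using (all?; toℕ-fromℕ<; toℕ-injective; toℕ<n) renaming (_≟_ to _≟ᶠ_)
open import Data.Vec using (Vec; lookup) renaming ([] to []ᵥ; _∷_ to _∷ᵥ_)
open import Data.List using (List; []; _∷_; _++_; map; filter; length; concatMap; tabulate; allFin)
open import Data.List.Properties using (map-cong)
open import Data.Sum using (_⊎_; inj₁; inj₂)
open import Data.Product using (_×_; _,_; proj₁; proj₂; ∃)
open import Data.Empty using (⊥; ⊥-elim)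
open import Function using (_∘_)
open import Function.Bundles using (module Equivalence; mk⇔)
open import Relation.Nullary using (¬_; Dec; yes; no; does; contradiction)
open import Relation.Nullary.Decidable
  using (from-yes; from-no; decidable-stable; dec-true; dec-false; does-⇔; ¬?; _×-dec_)
open import Relation.Unary using (Decidable)
open import Relation.Binary.Bundles using (Setoid)
open import Relation.Binary.Definitions using (tri<; tri≈; tri>)
import Relation.Binary.Reasoning.Setoid
open import Relation.Binary.PropositionalEquality hiding ([_])
open import Defs

≡⇒≡ᵇ≡true : ∀ {m n} → m ≡ n → (m ≡ᵇ n) ≡ true
≡⇒≡ᵇ≡true {m} {n} m≡n = Equivalence.to T-≡ (≡⇒≡ᵇ m n m≡n)

≢⇒≡ᵇ≡false : ∀ {m n} → m ≢ n → (m ≡ᵇ n) ≡ false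
≢⇒≡ᵇ≡false {m} {n} m≢n with m ≡ᵇ n in eq
... | true  = contradiction (≡ᵇ⇒≡ m n (subst T (sym eq) _)) m≢n
... | false = refl

≡ᵇ≡true⇒≡ : ∀ {m n} → (m ≡ᵇ n) ≡ true → m ≡ n
≡ᵇ≡true⇒≡ {m} {n} eq = ≡ᵇ⇒≡ m n (Equivalence.from T-≡ eq)

∧-≡true : ∀ {x y} → x ∧ y ≡ true → x ≡ true × y ≡ true
∧-≡true {true} {true} _ = refl , refl

∨-≡true : ∀ {x y} → x ∨ y ≡ true → x ≡ true ⊎ y ≡ true
∨-≡true {true}  _ = inj₁ refl
∨-≡true {false} e = inj₂ e

∨-≡trueˡ : ∀ {x} y → x ≡ true → x ∨ y ≡ true
∨-≡trueˡ y refl = refl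

∨-≡trueʳ : ∀ x {y} → y ≡ true → x ∨ y ≡ true
∨-≡trueʳ true  _ = refl
∨-≡trueʳ false e = e

if-false : ∀ {A : Set} b {x y : A} → ¬ T b → (if b then x else y) ≡ y
if-false true  ¬b = contradiction _ ¬b
if-false false _  = refl

if-true : ∀ {A : Set} b {x y : A} → T b → (if b then x else y) ≡ x
if-true true _ = refl

if≢0 : ∀ b {x : ℕ} → (if b then x else 0) ≢ 0 → b ≡ true
if≢0 true  _  = refl
if≢0 false ≢0 = contradiction refl ≢0

does≡true⇒ : ∀ {A : Set} (a? : Dec A) → does a? ≡ true → A
does≡true⇒ (yes a) _ = a

does≡ : ∀ {P : Set} (d : Dec P) b → (P → b ≡ true) → (b ≡ true → P) → does d ≡ b
does≡ (yes p) b P⇒b _   = sym (P⇒b p)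
does≡ (no ¬p) true _ b⇒P = contradiction (b⇒P refl) ¬p
does≡ (no ¬p) false _ _  = refl

-- f a b c is the coefficient of c₀^a c₁^b c₃^c.
Poly : Set
Poly = ℕ → ℕ → ℕ → ℕ

0ₚ : Poly
0ₚ _ _ _ = 0

1ₚ : Poly
1ₚ zero zero zero = 1
1ₚ _    _    _    = 0

infixl 6 _+ₚ_
_+ₚ_ : Poly → Poly → Poly
(f +ₚ g) a b c = f a b c + g a b c

infix 4 _≈ₚ_
_≈ₚ_ : Poly → Poly → Set
f ≈ₚ g = ∀ a b c → f a b c ≡ g a b c

≈ₚ-setoid : Setoid 0ℓ 0ℓ
≈ₚ-setoid = record
  { Carrier = Poly
  ; _≈_ = _≈ₚ_
  ; isEquivalence = record
    { refl  = λ _ _ _ → refl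
    ; sym   = λ p a b c → sym (p a b c)
    ; trans = λ p q a b c → trans (p a b c) (q a b c)
    }
  }

open Setoid ≈ₚ-setoid public using () renaming (refl to ≈ₚ-refl; sym to ≈ₚ-sym; trans to ≈ₚ-trans)

module ≈ₚ-Reasoning = Relation.Binary.Reasoning.Setoid ≈ₚ-setoid

+ₚ-cong : ∀ {f f′ g g′} → f ≈ₚ f′ → g ≈ₚ g′ → f +ₚ g ≈ₚ f′ +ₚ g′
+ₚ-cong p q a b c = cong₂ _+_ (p a b c) (q a b c)

+ₚ-comm : ∀ f g → f +ₚ g ≈ₚ g +ₚ f
+ₚ-comm f g a b c = +-comm (f a b c) (g a b c)

data Var : Set where
  c₀ c₁ c₃ : Var

-- Multiplication by a variable, generic in the coefficient type (z being the
-- coefficient of the monomials not divisible by the variable) so that it also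
-- acts on 0/1-valued indicators.
shiftWith : {A : Set} → A → Var → (ℕ → ℕ → ℕ → A) → ℕ → ℕ → ℕ → A
shiftWith z c₀ f zero    b       c       = z
shiftWith z c₀ f (suc a) b       c       = f a b c
shiftWith z c₁ f a       zero    c       = z
shiftWith z c₁ f a       (suc b) c       = f a b c
shiftWith z c₃ f a       b       zero    = z
shiftWith z c₃ f a       b       (suc c) = f a b c

infixr 8 _·_
_·_ : Var → Poly → Poly
x · f = shiftWith 0 x f

·-cong : ∀ x {f g} → f ≈ₚ g → x · f ≈ₚ x · g
·-cong c₀ p zero    b       c       = refl
·-cong c₀ p (suc a) b       c       = p a b c
·-cong c₁ p a       zero    c       = refl
·-cong c₁ p a       (suc b) c       = p a b c
·-cong c₃ p a       b       zero    = refl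
·-cong c₃ p a       b       (suc c) = p a b c

·-distrib-+ₚ : ∀ x f g → x · (f +ₚ g) ≈ₚ x · f +ₚ x · g
·-distrib-+ₚ c₀ f g zero    b       c       = refl
·-distrib-+ₚ c₀ f g (suc a) b       c       = refl
·-distrib-+ₚ c₁ f g a       zero    c       = refl
·-distrib-+ₚ c₁ f g a       (suc b) c       = refl
·-distrib-+ₚ c₃ f g a       b       zero    = refl
·-distrib-+ₚ c₃ f g a       b       (suc c) = refl

·-comm-c₃ : ∀ x f → x · c₃ · f ≈ₚ c₃ · x · f
·-comm-c₃ c₀ f zero    b zero    = refl
·-comm-c₃ c₀ f zero    b (suc c) = refl
·-comm-c₃ c₀ f (suc a) b zero    = refl
·-comm-c₃ c₀ f (suc a) b (suc c) = refl
·-comm-c₃ c₁ f a zero    zero    = refl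
·-comm-c₃ c₁ f a zero    (suc c) = refl
·-comm-c₃ c₁ f a (suc b) zero    = refl
·-comm-c₃ c₁ f a (suc b) (suc c) = refl
·-comm-c₃ c₃ f a b c             = refl

-- The transfer recursion

inAᵇ inBᵇ : ℕ → Bool
inAᵇ t = not ((t ≡ᵇ 0) ∨ (t ≡ᵇ 1) ∨ (t ≡ᵇ 3))
inBᵇ t = not ((t ≡ᵇ 0) ∨ (t ≡ᵇ 1) ∨ (t ≡ᵇ 6))

-- tailGF m h₃ h₂ h₁ counts, by weight, the ways to choose f on the last m
-- positions n − m, …, n − 1 of A.  Position n − m may be sent to m, m + 1 or
-- m + 3 (weight c₀, c₁, c₃); hₖ records whether the target m + k is already
-- covered, and target m + 3 must be covered (if it lies in B) once position
-- n − m is passed, since no later position can reach it.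
allow₀ : ℕ → Bool → Bool
allow₀ m h₃ = (not (inBᵇ (3 + m)) ∨ h₃) ∧ inBᵇ m

allow₁ : ℕ → Bool → Bool → Bool
allow₁ m h₃ h₁ = (not (inBᵇ (3 + m)) ∨ h₃) ∧ (not h₁ ∧ inBᵇ (1 + m))

allow₃ : ℕ → Bool → Bool
allow₃ m h₃ = not h₃ ∧ inBᵇ (3 + m)

tailGF : ℕ → Bool → Bool → Bool → Poly
tailGF zero    h₃ h₂ h₁ = if h₃ ∧ h₂ then 1ₚ else 0ₚ
tailGF (suc k) h₃ h₂ h₁ =
      (if allow₀ (suc k) h₃    then c₀ · tailGF k h₂ h₁ true    else 0ₚ)
  +ₚ (if allow₁ (suc k) h₃ h₁ then c₁ · tailGF k h₂ true false else 0ₚ)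
  +ₚ (if allow₃ (suc k) h₃    then c₃ · tailGF k h₂ h₁ false   else 0ₚ)

-- For n = 10 + i: positions 0, 1, 3 are not in A and position 2 has only the
-- choices c₀, c₁.
matchingPoly : ℕ → Poly
matchingPoly i = c₀ · tailGF (6 + i) false true false +ₚ c₁ · tailGF (6 + i) true false false

private
  tailGF₃ : ℕ → Poly
  tailGF₃ m = tailGF m true false false

  -- Unfolding tailGF, the state (true, false, false) returns to itself via c₁ c₃
  -- or c₀ c₃ c₃ and every other path dies (7 + j avoids the special targets).
  tailGF₃-unfold : ∀ j → tailGF₃ (7 + j) ≈ₚ c₀ · c₃ · c₃ · tailGF₃ (4 + j) +ₚ c₁ · c₃ · tailGF₃ (5 + j)
  tailGF₃-unfold j a b c = +-identityʳ _

  matchingPoly-tailGF₃ : ∀ i → matchingPoly i ≈ₚ c₀ · c₃ · tailGF₃ (5 + i) +ₚ c₁ · tailGF₃ (6 + i)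
  matchingPoly-tailGF₃ i a b c = refl

matchingPoly-rec : ∀ i →
  matchingPoly (3 + i) ≈ₚ c₁ · c₃ · matchingPoly (1 + i) +ₚ c₀ · c₃ · c₃ · matchingPoly i
matchingPoly-rec i = begin
  matchingPoly (3 + i)
    ≈⟨ matchingPoly-tailGF₃ (3 + i) ⟩
  c₀ · c₃ · tailGF₃ (8 + i) +ₚ c₁ · tailGF₃ (9 + i)
    ≈⟨ +ₚ-cong (·-cong c₀ (·-cong c₃ (tailGF₃-unfold (1 + i)))) (·-cong c₁ (tailGF₃-unfold (2 + i))) ⟩
  c₀ · c₃ · (c₀ · c₃ · c₃ · p +ₚ c₁ · c₃ · q) +ₚ c₁ · (c₀ · c₃ · c₃ · q +ₚ c₁ · c₃ · r)
    ≈⟨ +ₚ-cong (expand c₀ c₃ (c₀ · c₃ · c₃ · p) (c₁ · c₃ · q)) (·-distrib-+ₚ c₁ _ _) ⟩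
  (c₀ · c₃ · c₀ · c₃ · c₃ · p +ₚ c₀ · c₃ · c₁ · c₃ · q) +ₚ (c₁ · c₀ · c₃ · c₃ · q +ₚ c₁ · c₁ · c₃ · r)
    ≈⟨ +ₚ-cong (+ₚ-cong (·-cong c₀ (·-cong c₃ (·-comm-c₃ c₀ _))) (·-cong c₀ (·-cong c₃ (·-comm-c₃ c₁ _))))
               (+ₚ-cong (·-cong c₁ (·-comm-c₃ c₀ _)) (·-cong c₁ (·-comm-c₃ c₁ _))) ⟩
  (c₀ · c₃ · c₃ · c₀ · c₃ · p +ₚ c₀ · c₃ · c₃ · c₁ · q) +ₚ (c₁ · c₃ · c₀ · c₃ · q +ₚ c₁ · c₃ · c₁ · r)
    ≈⟨ +ₚ-comm (c₀ · c₃ · c₃ · c₀ · c₃ · p +ₚ c₀ · c₃ · c₃ · c₁ · q) _ ⟩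
  (c₁ · c₃ · c₀ · c₃ · q +ₚ c₁ · c₃ · c₁ · r) +ₚ (c₀ · c₃ · c₃ · c₀ · c₃ · p +ₚ c₀ · c₃ · c₃ · c₁ · q)
    ≈⟨ +ₚ-cong (≈ₚ-sym (expand c₁ c₃ _ _)) (≈ₚ-sym (expand₃ _ _)) ⟩
  c₁ · c₃ · (c₀ · c₃ · q +ₚ c₁ · r) +ₚ c₀ · c₃ · c₃ · (c₀ · c₃ · p +ₚ c₁ · q)
    ≈⟨ +ₚ-cong (·-cong c₁ (·-cong c₃ (matchingPoly-tailGF₃ (1 + i)))) (·-cong c₀ (·-cong c₃ (·-cong c₃ (matchingPoly-tailGF₃ i)))) ⟨
  c₁ · c₃ · matchingPoly (1 + i) +ₚ c₀ · c₃ · c₃ · matchingPoly i ∎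
  where
  open ≈ₚ-Reasoning
  p = tailGF₃ (5 + i)
  q = tailGF₃ (6 + i)
  r = tailGF₃ (7 + i)
  expand : ∀ x y f g → x · y · (f +ₚ g) ≈ₚ x · y · f +ₚ x · y · g
  expand x y f g = ≈ₚ-trans (·-cong x (·-distrib-+ₚ y f g)) (·-distrib-+ₚ x _ _)
  expand₃ : ∀ f g → c₀ · c₃ · c₃ · (f +ₚ g) ≈ₚ c₀ · c₃ · c₃ · f +ₚ c₀ · c₃ · c₃ · g
  expand₃ f g = ≈ₚ-trans (·-cong c₀ (expand c₃ c₃ f g)) (·-distrib-+ₚ c₀ _ _)

-- The binomial sum

-- C(a+b−2, b), C(a+b−3, b−1) and C(a+b−3, b−3), the binomials with a negative
-- lower index being 0.  The truncated upper index a + b ∸ k is harmless: the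
-- terms are only compared with the integer binomials when a + b ≥ 3.
term₁ term₂ term₃ : ℕ → ℕ → ℕ
term₁ a b = (a + b ∸ 2) C b

term₂ a zero    = 0
term₂ a (suc b) = term₁ a b

term₃ a (suc (suc (suc b))) = (a + b) C b
term₃ a _                   = 0

binomialSum : ℕ → ℕ → ℕ
binomialSum a b = term₁ a b + term₂ a b + term₃ a b

onSupport : ℕ → ℕ → ℕ → ℕ → Bool
onSupport n a b c = (a + b + c ≡ᵇ n ∸ 3) ∧ (2 * a + b + 1 ≡ᵇ c + 6)

rhsPoly : ℕ → Poly
rhsPoly n a b c = if onSupport n a b c then binomialSum a b else 0

term₁-pascal : ∀ a b → 1 ≤ a + b → term₁ (suc a) (suc b) ≡ term₁ (suc a) b + term₁ a (suc b)
term₁-pascal a b 1≤a+b = begin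
  (a + suc b ∸ 1) C suc b ≡⟨ cong (λ s → (s ∸ 1) C suc b) (+-suc a b) ⟩
  (a + b) C suc b         ≡⟨ cong (_C suc b) (m+[n∸m]≡n 1≤a+b) ⟨
  suc m C suc b           ≡⟨ nCk+nC[k+1]≡[n+1]C[k+1] m b ⟨
  m C b + m C suc b       ≡⟨ cong (λ s → m C b + (s ∸ 2) C suc b) (+-suc a b) ⟨
  term₁ (suc a) b + term₁ a (suc b) ∎
  where
  open ≡-Reasoning
  m = a + b ∸ 1

term₂-pascal : ∀ a b → 2 ≤ a + b → term₂ (suc a) (suc b) ≡ term₂ (suc a) b + term₂ a (suc b)
term₂-pascal a zero    _      = refl
term₂-pascal a (suc b) 2≤a+b = term₁-pascal a b (≤-pred (≤-trans 2≤a+b (≤-reflexive (+-suc a b))))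

term₃-pascal : ∀ a b → term₃ (suc a) (suc b) ≡ term₃ (suc a) b + term₃ a (suc b)
term₃-pascal a zero                = refl
term₃-pascal a (suc zero)          = refl
term₃-pascal a (suc (suc zero))    = refl
term₃-pascal a (suc (suc (suc b))) = begin
  suc (a + suc b) C suc b     ≡⟨ nCk+nC[k+1]≡[n+1]C[k+1] (a + suc b) b ⟨
  (a + suc b) C b + (a + suc b) C suc b ≡⟨ cong (λ s → s C b + (a + suc b) C suc b) (+-suc a b) ⟩
  suc (a + b) C b + (a + suc b) C suc b ∎
  where open ≡-Reasoning

binomialSum-pascal : ∀ a b → 2 ≤ a + b →
  binomialSum (suc a) (suc b) ≡ binomialSum (suc a) b + binomialSum a (suc b)
binomialSum-pascal a b 2≤a+b = begin
  term₁ (suc a) (suc b) + term₂ (suc a) (suc b) + term₃ (suc a) (suc b)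
    ≡⟨ cong₂ _+_ (cong₂ _+_ (term₁-pascal a b (≤-trans (s≤s z≤n) 2≤a+b)) (term₂-pascal a b 2≤a+b)) (term₃-pascal a b) ⟩
  (t₁ + t₁′) + (t₂ + t₂′) + (t₃ + t₃′)
    ≡⟨ shuffle t₁ t₁′ t₂ t₂′ t₃ t₃′ ⟩
  (t₁ + t₂ + t₃) + (t₁′ + t₂′ + t₃′) ∎
  where
  open ≡-Reasoning
  t₁ = term₁ (suc a) b
  t₂ = term₂ (suc a) b
  t₃ = term₃ (suc a) b
  t₁′ = term₁ a (suc b)
  t₂′ = term₂ a (suc b)
  t₃′ = term₃ a (suc b)
  shuffle : ∀ x x′ y y′ z z′ → (x + x′) + (y + y′) + (z + z′) ≡ (x + y + z) + (x′ + y′ + z′)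
  shuffle = solve-∀

binomialSum-0 : ∀ b → binomialSum 0 (3 + b) ≡ 1
binomialSum-0 b = begin
  term₁ 0 (3 + b) + term₁ 0 (2 + b) + b C b
    ≡⟨ cong₂ (λ x y → x + y + b C b) (k>n⇒nCk≡0 (m<n⇒m<1+n (n<1+n (suc b)))) (k>n⇒nCk≡0 (m<n⇒m<1+n (n<1+n b))) ⟩
  b C b ≡⟨ nCn≡1 b ⟩
  1 ∎
  where open ≡-Reasoning

-- the coefficients contributed by the c₁ c₃ and the c₀ c₃ c₃ term of the recurrence
viaC₁ viaC₀ : ℕ → ℕ → ℕ
viaC₁ a zero    = 0
viaC₁ a (suc b) = binomialSum a b

viaC₀ zero    b = 0
viaC₀ (suc a) b = binomialSum a b

binomialSum-rec : ∀ a b → 15 ≤ 3 * a + 2 * b → binomialSum a b ≡ viaC₁ a b + viaC₀ a b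
binomialSum-rec (suc a) zero _ = sym (+-identityˡ _)
binomialSum-rec zero (suc (suc (suc (suc b)))) _ =
  trans (binomialSum-0 (suc b)) (sym (trans (+-identityʳ _) (binomialSum-0 b)))
binomialSum-rec (suc (suc (suc a))) (suc b)             _ = binomialSum-pascal (2 + a) b (s≤s (s≤s z≤n))
binomialSum-rec (suc (suc zero))    (suc (suc b))       _ = binomialSum-pascal 1 (suc b) (s≤s (s≤s z≤n))
binomialSum-rec (suc zero)          (suc (suc (suc b))) _ = binomialSum-pascal 0 (2 + b) (s≤s (s≤s z≤n))
binomialSum-rec zero             zero                   h = contradiction h (from-no (15 ≤? 0))
binomialSum-rec zero             (suc zero)             h = contradiction h (from-no (15 ≤? 2))
binomialSum-rec zero             (suc (suc zero))       h = contradiction h (from-no (15 ≤? 4))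
binomialSum-rec zero             (suc (suc (suc zero))) h = contradiction h (from-no (15 ≤? 6))
binomialSum-rec (suc zero)       (suc zero)             h = contradiction h (from-no (15 ≤? 5))
binomialSum-rec (suc zero)       (suc (suc zero))       h = contradiction h (from-no (15 ≤? 7))
binomialSum-rec (suc (suc zero)) (suc zero)             h = contradiction h (from-no (15 ≤? 8))

onSupport-shape : ∀ n a b c → T (onSupport n a b c) →
  2 * a + b ≡ c + 5 × 3 * a + 2 * b ≡ (n ∸ 3) + 5
onSupport-shape n a b c onS = 2a+b≡c+5 , +-cancelʳ-≡ c _ _ (begin
    3 * a + 2 * b + c         ≡⟨ regroup a b c ⟩
    (a + b + c) + (2 * a + b) ≡⟨ cong₂ _+_ sum≡m 2a+b≡c+5 ⟩
    m + (c + 5)               ≡⟨ regroup′ m c ⟩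
    m + 5 + c                 ∎)
  where
  open ≡-Reasoning
  m = n ∸ 3
  sum≡m : a + b + c ≡ m
  sum≡m = ≡ᵇ⇒≡ _ _ (proj₁ (Equivalence.to T-∧ onS))
  2a+b≡c+5 : 2 * a + b ≡ c + 5
  2a+b≡c+5 = +-cancelʳ-≡ 1 _ _ (trans (≡ᵇ⇒≡ _ _ (proj₂ (Equivalence.to T-∧ onS))) (sym (+-assoc c 5 1)))
  regroup : ∀ a b c → 3 * a + 2 * b + c ≡ (a + b + c) + (2 * a + b)
  regroup = solve-∀
  regroup′ : ∀ m c → m + (c + 5) ≡ m + 5 + c
  regroup′ = solve-∀

3a+2b≤3[a+b] : ∀ a b → 3 * a + 2 * b ≤ 3 * (a + b)
3a+2b≤3[a+b] a b = ≤-trans (m≤m+n _ b) (≤-reflexive (regroup a b))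
  where
  regroup : ∀ a b → 3 * a + 2 * b + b ≡ 3 * (a + b)
  regroup = solve-∀

onSupport⇒3≤a+b : ∀ n a b c → 10 ≤ n → T (onSupport n a b c) → 3 ≤ a + b
onSupport⇒3≤a+b n a b c 10≤n onS with 3 ≤? a + b
... | yes 3≤a+b = 3≤a+b
... | no  3≰a+b = contradiction 12≤6 (from-no (12 ≤? 6))
  where
  open ≤-Reasoning
  12≤6 : 12 ≤ 6
  12≤6 = begin
    12                ≤⟨ +-monoˡ-≤ 5 (∸-monoˡ-≤ 3 10≤n) ⟩
    (n ∸ 3) + 5       ≡⟨ proj₂ (onSupport-shape n a b c onS) ⟨
    3 * a + 2 * b     ≤⟨ 3a+2b≤3[a+b] a b ⟩
    3 * (a + b)       ≤⟨ *-monoʳ-≤ 3 (≤-pred (≰⇒> 3≰a+b)) ⟩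
    6                 ∎

onSupport⇒2≤c : ∀ n a b c → 13 ≤ n → T (onSupport n a b c) → 2 ≤ c
onSupport⇒2≤c n a b c 13≤n onS with 2 ≤? c | onSupport-shape n a b c onS
... | yes 2≤c | _ = 2≤c
... | no  2≰c | 2a+b≡c+5 , 3a+2b≡m+5 = contradiction 15≤12 (from-no (15 ≤? 12))
  where
  open ≤-Reasoning
  15≤12 : 15 ≤ 12
  15≤12 = begin
    15                    ≤⟨ +-monoˡ-≤ 5 (∸-monoˡ-≤ 3 13≤n) ⟩
    (n ∸ 3) + 5           ≡⟨ 3a+2b≡m+5 ⟨
    3 * a + 2 * b         ≤⟨ m≤m+n _ a ⟩
    3 * a + 2 * b + a     ≡⟨ regroup a b ⟩
    2 * (2 * a + b)       ≡⟨ cong (2 *_) 2a+b≡c+5 ⟩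
    2 * (c + 5)           ≤⟨ *-monoʳ-≤ 2 (+-monoˡ-≤ 5 (≤-pred (≰⇒> 2≰c))) ⟩
    12                    ∎
    where
    regroup : ∀ a b → 3 * a + 2 * b + a ≡ 2 * (2 * a + b)
    regroup = solve-∀

onSupport-c₁c₃ : ∀ m a b c → onSupport (3 + m) a b c ≡ onSupport (5 + m) a (suc b) (suc c)
onSupport-c₁c₃ m a b c =
  cong₂ _∧_ (cong (_≡ᵇ 2 + m) (shift₁ a b c)) (cong (_≡ᵇ suc c + 6) (shift₂ a b))
  where
  shift₁ : ∀ a b c → 2 + (a + b + c) ≡ a + suc b + suc c
  shift₁ = solve-∀
  shift₂ : ∀ a b → 1 + (2 * a + b + 1) ≡ 2 * a + suc b + 1
  shift₂ = solve-∀

onSupport-c₀c₃c₃ : ∀ m a b c → onSupport (3 + m) a b c ≡ onSupport (6 + m) (suc a) b (suc (suc c))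
onSupport-c₀c₃c₃ m a b c =
  cong₂ _∧_ (cong (_≡ᵇ 3 + m) (shift₁ a b c)) (cong (_≡ᵇ suc (suc c) + 6) (shift₂ a b))
  where
  shift₁ : ∀ a b c → 3 + (a + b + c) ≡ suc a + b + suc (suc c)
  shift₁ = solve-∀
  shift₂ : ∀ a b → 2 + (2 * a + b + 1) ≡ 2 * suc a + b + 1
  shift₂ = solve-∀

rhsPoly-c₁c₃ : ∀ i a b c →
  (c₁ · c₃ · rhsPoly (11 + i)) a b c ≡ (if onSupport (13 + i) a b c then viaC₁ a b else 0)
rhsPoly-c₁c₃ i a zero    c       = sym (if-eta (onSupport (13 + i) a 0 c))
rhsPoly-c₁c₃ i a (suc b) zero    =
  sym (if-false _ (λ onS → contradiction (onSupport⇒2≤c (13 + i) a (suc b) 0 (m≤m+n 13 i) onS) λ ()))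
rhsPoly-c₁c₃ i a (suc b) (suc c) = if-cong (onSupport-c₁c₃ (8 + i) a b c)

rhsPoly-c₀c₃c₃ : ∀ i a b c →
  (c₀ · c₃ · c₃ · rhsPoly (10 + i)) a b c ≡ (if onSupport (13 + i) a b c then viaC₀ a b else 0)
rhsPoly-c₀c₃c₃ i zero    b c             = sym (if-eta (onSupport (13 + i) 0 b c))
rhsPoly-c₀c₃c₃ i (suc a) b (suc (suc c)) = if-cong (onSupport-c₀c₃c₃ (7 + i) a b c)
rhsPoly-c₀c₃c₃ i (suc a) b zero          =
  sym (if-false _ (λ onS → contradiction (onSupport⇒2≤c (13 + i) (suc a) b 0 (m≤m+n 13 i) onS) λ ()))
rhsPoly-c₀c₃c₃ i (suc a) b (suc zero)    =
  sym (if-false _ (λ onS → contradiction (onSupport⇒2≤c (13 + i) (suc a) b 1 (m≤m+n 13 i) onS) λ { (s≤s ()) }))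

rhsPoly-rec : ∀ i → rhsPoly (13 + i) ≈ₚ c₁ · c₃ · rhsPoly (11 + i) +ₚ c₀ · c₃ · c₃ · rhsPoly (10 + i)
rhsPoly-rec i a b c rewrite rhsPoly-c₁c₃ i a b c | rhsPoly-c₀c₃c₃ i a b c
  with onSupport (13 + i) a b c in onS
... | true  = binomialSum-rec a b (begin
      15             ≤⟨ m≤m+n 15 i ⟩
      15 + i         ≡⟨ cong (λ x → 10 + x) (+-comm 5 i) ⟩
      10 + i + 5     ≡⟨ proj₂ (onSupport-shape (13 + i) a b c (subst T (sym onS) _)) ⟨
      3 * a + 2 * b  ∎)
  where open ≤-Reasoning
... | false = refl

Homogeneous : ℕ → Poly → Set
Homogeneous d f = ∀ a b c → a + b + c ≢ d → f a b c ≡ 0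

1ₚ-homogeneous : Homogeneous 0 1ₚ
1ₚ-homogeneous zero    zero    zero    ≢0 = contradiction refl ≢0
1ₚ-homogeneous zero    zero    (suc c) _  = refl
1ₚ-homogeneous zero    (suc b) c       _  = refl
1ₚ-homogeneous (suc a) b       c       _  = refl

·-homogeneous : ∀ x {d f} → Homogeneous d f → Homogeneous (suc d) (x · f)
·-homogeneous c₀ hf zero    b       c       _   = refl
·-homogeneous c₀ hf (suc a) b       c       ≢sd = hf a b c (λ e → ≢sd (cong suc e))
·-homogeneous c₁ hf a       zero    c       _   = refl
·-homogeneous c₁ hf a       (suc b) c       ≢sd = hf a b c (λ e → ≢sd (trans (cong (_+ c) (+-suc a b)) (cong suc e)))
·-homogeneous c₃ hf a       b       zero    _   = refl
·-homogeneous c₃ hf a       b       (suc c) ≢sd = hf a b c (λ e → ≢sd (trans (+-suc (a + b) c) (cong suc e)))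

+ₚ-homogeneous : ∀ {d f g} → Homogeneous d f → Homogeneous d g → Homogeneous d (f +ₚ g)
+ₚ-homogeneous hf hg a b c ≢d = cong₂ _+_ (hf a b c ≢d) (hg a b c ≢d)

if-homogeneous : ∀ {d f} b → Homogeneous d f → Homogeneous d (if b then f else 0ₚ)
if-homogeneous true  hf = hf
if-homogeneous false hf _ _ _ _ = refl

tailGF-homogeneous : ∀ m h₃ h₂ h₁ → Homogeneous m (tailGF m h₃ h₂ h₁)
tailGF-homogeneous zero    h₃ h₂ h₁ = if-homogeneous (h₃ ∧ h₂) 1ₚ-homogeneous
tailGF-homogeneous (suc k) h₃ h₂ h₁ =
  +ₚ-homogeneous (+ₚ-homogeneous
    (if-homogeneous (allow₀ (suc k) h₃) (·-homogeneous c₀ (tailGF-homogeneous k h₂ h₁ true)))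
    (if-homogeneous (allow₁ (suc k) h₃ h₁) (·-homogeneous c₁ (tailGF-homogeneous k h₂ true false))))
    (if-homogeneous (allow₃ (suc k) h₃) (·-homogeneous c₃ (tailGF-homogeneous k h₂ h₁ false)))

matchingPoly-homogeneous : ∀ i → Homogeneous (7 + i) (matchingPoly i)
matchingPoly-homogeneous i =
  +ₚ-homogeneous (·-homogeneous c₀ (tailGF-homogeneous (6 + i) false true false))
                 (·-homogeneous c₁ (tailGF-homogeneous (6 + i) true false false))

rhsPoly-homogeneous : ∀ n → Homogeneous (n ∸ 3) (rhsPoly n)
rhsPoly-homogeneous n a b c ≢d = if-false (onSupport n a b c) (λ onS → ≢d (≡ᵇ⇒≡ _ _ (proj₁ (Equivalence.to T-∧ onS))))

-- Homogeneous polynomials of degree d are compared on the finitely many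
-- monomials c₀^a c₁^b c₃^(d − a − b); this makes the comparison decidable by
-- evaluation.
AgreeOnDegree : ℕ → Poly → Poly → Set
AgreeOnDegree d f g = ∀ (a b : Fin (suc d)) →
  f (toℕ a) (toℕ b) (d ∸ toℕ a ∸ toℕ b) ≡ g (toℕ a) (toℕ b) (d ∸ toℕ a ∸ toℕ b)

agreeOnDegree? : ∀ d f g → Dec (AgreeOnDegree d f g)
agreeOnDegree? d f g = all? λ a → all? λ b → _ ≟ _

homogeneous-≈ₚ : ∀ d {f g} → Homogeneous d f → Homogeneous d g → AgreeOnDegree d f g → f ≈ₚ g
homogeneous-≈ₚ d {f} {g} hf hg agree a b c with a + b + c ≟ d
... | no  ≢d   = trans (hf a b c ≢d) (sym (hg a b c ≢d))
... | yes refl = subst (λ z → f a b z ≡ g a b z) (a+b+c∸a∸b≡c a b c)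
                   (at (fromℕ< (s≤s a≤d)) (fromℕ< (s≤s b≤d)) (toℕ-fromℕ< _) (toℕ-fromℕ< _))
  where
  a≤d : a ≤ a + b + c
  a≤d = ≤-trans (m≤m+n a b) (m≤m+n (a + b) c)
  b≤d : b ≤ a + b + c
  b≤d = ≤-trans (m≤n+m b a) (m≤m+n (a + b) c)
  at : ∀ {a′ b′} (x y : Fin (suc (a + b + c))) → toℕ x ≡ a′ → toℕ y ≡ b′ →
       f a′ b′ (a + b + c ∸ a′ ∸ b′) ≡ g a′ b′ (a + b + c ∸ a′ ∸ b′)
  at x y refl refl = agree x y
  a+b+c∸a∸b≡c : ∀ a b c → a + b + c ∸ a ∸ b ≡ c
  a+b+c∸a∸b≡c a b c = trans (cong (_∸ b) (trans (cong (_∸ a) (+-assoc a b c)) (m+n∸m≡n a (b + c)))) (m+n∸m≡n b c)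

matchingPoly≈rhsPoly : ∀ i → matchingPoly i ≈ₚ rhsPoly (10 + i)
matchingPoly≈rhsPoly 0 = homogeneous-≈ₚ 7 (matchingPoly-homogeneous 0) (rhsPoly-homogeneous 10)
  (from-yes (agreeOnDegree? 7 (matchingPoly 0) (rhsPoly 10)))
matchingPoly≈rhsPoly 1 = homogeneous-≈ₚ 8 (matchingPoly-homogeneous 1) (rhsPoly-homogeneous 11)
  (from-yes (agreeOnDegree? 8 (matchingPoly 1) (rhsPoly 11)))
matchingPoly≈rhsPoly 2 = homogeneous-≈ₚ 9 (matchingPoly-homogeneous 2) (rhsPoly-homogeneous 12)
  (from-yes (agreeOnDegree? 9 (matchingPoly 2) (rhsPoly 12)))
matchingPoly≈rhsPoly (suc (suc (suc i))) = begin
  matchingPoly (3 + i)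
    ≈⟨ matchingPoly-rec i ⟩
  c₁ · c₃ · matchingPoly (1 + i) +ₚ c₀ · c₃ · c₃ · matchingPoly i
    ≈⟨ +ₚ-cong (·-cong c₁ (·-cong c₃ (matchingPoly≈rhsPoly (suc i))))
               (·-cong c₀ (·-cong c₃ (·-cong c₃ (matchingPoly≈rhsPoly i)))) ⟩
  c₁ · c₃ · rhsPoly (11 + i) +ₚ c₀ · c₃ · c₃ · rhsPoly (10 + i)
    ≈⟨ rhsPoly-rec i ⟨
  rhsPoly (13 + i) ∎
  where open ≈ₚ-Reasoning

count : ∀ {A : Set} → (A → Bool) → List A → ℕ
count p []       = 0
count p (x ∷ xs) = (if p x then 1 else 0) + count p xs

length-filter≡count : ∀ {A : Set} {P : A → Set} (P? : Decidable P) xs →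
  length (filter P? xs) ≡ count (does ∘ P?) xs
length-filter≡count P? []       = refl
length-filter≡count P? (x ∷ xs) with does (P? x)
... | true  = cong suc (length-filter≡count P? xs)
... | false = length-filter≡count P? xs

count-cong : ∀ {A : Set} {p q : A → Bool} → (∀ x → p x ≡ q x) → ∀ xs → count p xs ≡ count q xs
count-cong p≡q []       = refl
count-cong p≡q (x ∷ xs) = cong₂ _+_ (cong (if_then 1 else 0) (p≡q x)) (count-cong p≡q xs)

count-++ : ∀ {A : Set} (p : A → Bool) xs ys → count p (xs ++ ys) ≡ count p xs + count p ys
count-++ p []       ys = refl
count-++ p (x ∷ xs) ys =
  trans (cong (px +_) (count-++ p xs ys)) (sym (+-assoc px (count p xs) (count p ys)))
  where px = if p x then 1 else 0

count-map : ∀ {A B : Set} (p : B → Bool) (f : A → B) xs → count p (map f xs) ≡ count (p ∘ f) xs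
count-map p f []       = refl
count-map p f (x ∷ xs) = cong (_ +_) (count-map p f xs)

count-false : ∀ {A : Set} (xs : List A) → count (λ _ → false) xs ≡ 0
count-false []       = refl
count-false (x ∷ xs) = count-false xs

count-∧ : ∀ {A : Set} c (p : A → Bool) xs → count (λ x → c ∧ p x) xs ≡ (if c then count p xs else 0)
count-∧ true  p xs = refl
count-∧ false p xs = count-false xs

count≡sum : ∀ {A : Set} (p : A → Bool) xs → count p xs ≡ sum (map (λ x → if p x then 1 else 0) xs)
count≡sum p []       = refl
count≡sum p (x ∷ xs) = cong (_ +_) (count≡sum p xs)

count-concatMap : ∀ {A B : Set} (p : B → Bool) (f : A → List B) xs →
  count p (concatMap f xs) ≡ sum (map (count p ∘ f) xs)
count-concatMap p f []       = refl
count-concatMap p f (x ∷ xs) = trans (count-++ p (f x) (concatMap f xs)) (cong (_ +_) (count-concatMap p f xs))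

sumBelow : (ℕ → ℕ) → ℕ → ℕ
sumBelow g zero    = 0
sumBelow g (suc m) = g 0 + sumBelow (g ∘ suc) m

sumBelow-cong : ∀ {f g} m → (∀ k → k < m → f k ≡ g k) → sumBelow f m ≡ sumBelow g m
sumBelow-cong zero    f≡g = refl
sumBelow-cong (suc m) f≡g = cong₂ _+_ (f≡g 0 z<s) (sumBelow-cong m (λ k k<m → f≡g (suc k) (s<s k<m)))

sumBelow-+ : ∀ f g m → sumBelow (λ k → f k + g k) m ≡ sumBelow f m + sumBelow g m
sumBelow-+ f g zero    = refl
sumBelow-+ f g (suc m) = trans (cong (f 0 + g 0 +_) (sumBelow-+ (f ∘ suc) (g ∘ suc) m))
                               (interchange (f 0) (g 0) _ _)
  where
  interchange : ∀ a b c d → a + b + (c + d) ≡ a + c + (b + d)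
  interchange = solve-∀

sum-allFin : ∀ n (g : ℕ → ℕ) → sum (map (g ∘ toℕ) (allFin n)) ≡ sumBelow g n
sum-allFin n g = sum-tabulate n 0 (λ i → i) (λ i → refl)
  where
  sum-tabulate : ∀ m o (f : Fin m → Fin n) → (∀ i → toℕ (f i) ≡ o + toℕ i) →
    sum (map (g ∘ toℕ) (tabulate f)) ≡ sumBelow (λ k → g (o + k)) m
  sum-tabulate zero    o f f≡ = refl
  sum-tabulate (suc m) o f f≡ = cong₂ _+_
    (cong g (f≡ fzero))
    (trans (sum-tabulate m (suc o) (f ∘ fsuc) (λ i → trans (f≡ (fsuc i)) (+-suc o (toℕ i))))
           (sumBelow-cong m (λ k _ → cong g (sym (+-suc o k)))))

atPoint : ℕ → ℕ → ℕ → ℕ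
atPoint p c k = if k ≡ᵇ p then c else 0

atPoint-≡ : ∀ p c → atPoint p c p ≡ c
atPoint-≡ zero    c = refl
atPoint-≡ (suc p) c = atPoint-≡ p c

atPoint-≢ : ∀ {p k} c → k ≢ p → atPoint p c k ≡ 0
atPoint-≢ {p} {k} c k≢p with k ≡ᵇ p in eq
... | true  = contradiction (≡ᵇ⇒≡ k p (subst T (sym eq) _)) k≢p
... | false = refl

sumBelow-atPoint : ∀ {p m} c → p < m → sumBelow (atPoint p c) m ≡ c
sumBelow-atPoint {zero}  {suc m} c _ = trans (cong (c +_) (sumBelow-zero m)) (+-identityʳ c)
  where
  sumBelow-zero : ∀ m → sumBelow (λ _ → 0) m ≡ 0
  sumBelow-zero zero    = refl
  sumBelow-zero (suc m) = sumBelow-zero m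
sumBelow-atPoint {suc p} {suc m} c (s<s p<m) = sumBelow-atPoint c p<m

sumBelow-atPoint-≥ : ∀ {p m} c → m ≤ p → sumBelow (atPoint p c) m ≡ 0
sumBelow-atPoint-≥ {p}     {zero}  c _         = refl
sumBelow-atPoint-≥ {suc p} {suc m} c (s≤s m≤p) = sumBelow-atPoint-≥ c m≤p

atPoint-of-vanishing : ∀ (g : ℕ → ℕ) p k → (g k ≢ 0 → k ≡ p) → g k ≡ atPoint p (g p) k
atPoint-of-vanishing g p k h with k ≟ p
... | yes refl = sym (atPoint-≡ k (g k))
... | no  k≢p  = trans gk≡0 (sym (atPoint-≢ (g p) k≢p))
  where
  gk≡0 : g k ≡ 0
  gk≡0 = decidable-stable (g k ≟ 0) (λ gk≢0 → k≢p (h gk≢0))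

sumBelow-one-point : ∀ (c : ℕ → Bool) (f : ℕ → ℕ) p m → p < m → (∀ k → k < m → c k ≡ true → k ≡ p) →
  sumBelow (λ k → if c k then f k else 0) m ≡ (if c p then f p else 0)
sumBelow-one-point c f p m p<m supp =
  trans (sumBelow-cong m (λ k k<m → atPoint-of-vanishing g p k (supp k k<m ∘ if≢0 (c k)))) (sumBelow-atPoint (g p) p<m)
  where
  g : ℕ → ℕ
  g k = if c k then f k else 0

sumBelow-three-points : ∀ (c : ℕ → Bool) (f : ℕ → ℕ) p q r m → p ≢ q → p ≢ r → q ≢ r →
  (∀ k → k < m → c k ≡ true → k ≡ p ⊎ k ≡ q ⊎ k ≡ r) →
  sumBelow (λ k → if c k then f k else 0) m ≡
  sumBelow (atPoint p (if c p then f p else 0)) m + sumBelow (atPoint q (if c q then f q else 0)) m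
    + sumBelow (atPoint r (if c r then f r else 0)) m
sumBelow-three-points c f p q r m p≢q p≢r q≢r supp =
  trans (sumBelow-cong m split)
        (trans (sumBelow-+ _ _ m) (cong (_+ sumBelow (atPoint r (g r)) m) (sumBelow-+ _ _ m)))
  where
  g : ℕ → ℕ
  g k = if c k then f k else 0
  split : ∀ k → k < m → g k ≡ atPoint p (g p) k + atPoint q (g q) k + atPoint r (g r) k
  split k k<m with g k ≟ 0
  ... | yes gk≡0 = trans gk≡0 (sym (cong₂ _+_ (cong₂ _+_ (vanish p) (vanish q)) (vanish r)))
    where
    vanish : ∀ s → atPoint s (g s) k ≡ 0
    vanish s = trans (sym (atPoint-of-vanishing g s k (λ gk≢0 → contradiction gk≡0 gk≢0))) gk≡0
  ... | no gk≢0 with supp k k<m (if≢0 (c k) gk≢0)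
  ...   | inj₁ refl = sym (trans (cong₂ _+_ (cong₂ _+_ (atPoint-≡ k (g k)) (atPoint-≢ _ p≢q)) (atPoint-≢ _ p≢r))
                                 (trans (+-identityʳ _) (+-identityʳ _)))
  ...   | inj₂ (inj₁ refl) = sym (trans (cong₂ _+_ (cong₂ _+_ (atPoint-≢ _ (p≢q ∘ sym)) (atPoint-≡ k (g k))) (atPoint-≢ _ q≢r))
                                        (+-identityʳ _))
  ...   | inj₂ (inj₂ refl) = sym (cong₂ _+_ (cong₂ _+_ (atPoint-≢ _ (p≢r ∘ sym)) (atPoint-≢ _ (q≢r ∘ sym))) (atPoint-≡ k (g k)))

-- The scanning automaton

Indicator : Set
Indicator = ℕ → ℕ → ℕ → Bool

1ᵇ : Indicator
1ᵇ zero zero zero = true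
1ᵇ _    _    _    = false

-- Multiplication by c₀, c₁, c₃ for d = 0, 1, 3, where a + f(a) = n + d.
shiftBy : {A : Set} → A → ℕ → (ℕ → ℕ → ℕ → A) → ℕ → ℕ → ℕ → A
shiftBy z 0 = shiftWith z c₀
shiftBy z 1 = shiftWith z c₁
shiftBy z 3 = shiftWith z c₃
shiftBy z _ = λ _ _ _ _ → z

count-shiftBy : ∀ {X : Set} d (g : X → Indicator) xs w₀ w₁ w₃ →
  count (λ u → shiftBy false d (g u) w₀ w₁ w₃) xs ≡ shiftBy 0 d (λ a b c → count (λ u → g u a b c) xs) w₀ w₁ w₃
count-shiftBy 0 g xs zero     w₁ w₃ = count-false xs
count-shiftBy 0 g xs (suc w₀) w₁ w₃ = refl
count-shiftBy 1 g xs w₀ zero     w₃ = count-false xs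
count-shiftBy 1 g xs w₀ (suc w₁) w₃ = refl
count-shiftBy 2 g xs w₀ w₁ w₃ = count-false xs
count-shiftBy 3 g xs w₀ w₁ zero     = count-false xs
count-shiftBy 3 g xs w₀ w₁ (suc w₃) = refl
count-shiftBy (suc (suc (suc (suc d)))) g xs w₀ w₁ w₃ = count-false xs

-- position a − j lies in A and is sent to b (p being its value)
hits : ℕ → ℕ → ℕ → ℕ → Bool
hits j a p b = inAᵇ (a ∸ j) ∧ (p ≡ᵇ b)

coveredBefore : ℕ → ℕ → ℕ → ℕ → Bool
coveredBefore a p₃ p₂ b = hits 2 a p₂ b ∨ hits 3 a p₃ b

fresh : ℕ → ℕ → ℕ → ℕ → ℕ → Bool
fresh a p₃ p₂ p₁ x = not (hits 1 a p₁ x ∨ (hits 2 a p₂ x ∨ hits 3 a p₃ x))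

finalCheck : ℕ → ℕ → ℕ → Bool
finalCheck p₃ p₂ p₁ = ((p₂ ≡ᵇ 3) ∨ (p₃ ≡ᵇ 3)) ∧ ((p₁ ≡ᵇ 2) ∨ (p₂ ≡ᵇ 2))

module Automaton (n : ℕ) ⦃ _ : NonZero n ⦄ where

  -- For 2 ≤ a, x < n this says a + x ∈ {0, 1, 3} (mod n).
  sumOK : ℕ → ℕ → Bool
  sumOK a x = (a + x ≡ᵇ n) ∨ (a + x ≡ᵇ 1 + n) ∨ (a + x ≡ᵇ 3 + n)

  sumOK⇒ : ∀ a x → sumOK a x ≡ true → a + x ≡ n ⊎ a + x ≡ 1 + n ⊎ a + x ≡ 3 + n
  sumOK⇒ a x ok with Equivalence.to T-∨ (Equivalence.from T-≡ ok)
  ... | inj₁ e = inj₁ (≡ᵇ⇒≡ _ _ e)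
  ... | inj₂ e with Equivalence.to T-∨ e
  ...   | inj₁ e′ = inj₂ (inj₁ (≡ᵇ⇒≡ _ _ e′))
  ...   | inj₂ e′ = inj₂ (inj₂ (≡ᵇ⇒≡ _ _ e′))

  coveredAt : ℕ → ℕ → ℕ → ℕ → ℕ → Bool
  coveredAt a p₃ p₂ x b = (not (inBᵇ b) ∨ coveredBefore a p₃ p₂ b) ∨ (x ≡ᵇ b)

  -- Position a is the last one that can reach the target n + 3 − a.
  covered : ℕ → ℕ → ℕ → ℕ → Bool
  covered a p₃ p₂ x = not (4 ≤ᵇ a) ∨ coveredAt a p₃ p₂ x (n + 3 ∸ a)

  admissible : ℕ → ℕ → ℕ → ℕ → ℕ → Bool
  admissible a p₃ p₂ p₁ x = inBᵇ x ∧ sumOK a x ∧ fresh a p₃ p₂ p₁ x ∧ covered a p₃ p₂ x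

  admissible⇒sumOK : ∀ a p₃ p₂ p₁ x → admissible a p₃ p₂ p₁ x ≡ true → sumOK a x ≡ true
  admissible⇒sumOK a p₃ p₂ p₁ x = second {inBᵇ x} {sumOK a x}
    where
    second : ∀ {i s r} → i ∧ (s ∧ r) ≡ true → s ≡ true
    second {true} {true} _ = refl

  -- the check at position a with value x, given the values p₃, p₂, p₁ at the
  -- three previous positions; outside A the vector is the identity
  localCheck : ℕ → ℕ → ℕ → ℕ → ℕ → Bool
  localCheck a p₃ p₂ p₁ x = if inAᵇ a then admissible a p₃ p₂ p₁ x else (x ≡ᵇ a)

  weigh : {A : Set} → A → ℕ → ℕ → (ℕ → ℕ → ℕ → A) → ℕ → ℕ → ℕ → A
  weigh z a x f = if inAᵇ a then shiftBy z (a + x ∸ n) f else f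

  accepts : ℕ → ℕ → ℕ → ℕ → ∀ {m} → Vec (Fin n) m → Indicator
  accepts a p₃ p₂ p₁ []ᵥ       w₀ w₁ w₃ = finalCheck p₃ p₂ p₁ ∧ 1ᵇ w₀ w₁ w₃
  accepts a p₃ p₂ p₁ (x ∷ᵥ u) w₀ w₁ w₃ =
    localCheck a p₃ p₂ p₁ (toℕ x) ∧ weigh false a (toℕ x) (accepts (suc a) p₂ p₁ (toℕ x) u) w₀ w₁ w₃

  countAccepted : ℕ → ℕ → ℕ → ℕ → ℕ → Poly
  countAccepted a p₃ p₂ p₁ m w₀ w₁ w₃ = count (λ u → accepts a p₃ p₂ p₁ u w₀ w₁ w₃) (allVecs n m)

  countAccepted-zero : ∀ a p₃ p₂ p₁ →
    countAccepted a p₃ p₂ p₁ 0 ≈ₚ (if finalCheck p₃ p₂ p₁ then 1ₚ else 0ₚ)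
  countAccepted-zero a p₃ p₂ p₁ w₀ w₁ w₃ with finalCheck p₃ p₂ p₁
  ... | false = refl
  ... | true  = count-1ᵇ w₀ w₁ w₃
    where
    count-1ᵇ : ∀ w₀ w₁ w₃ → (if 1ᵇ w₀ w₁ w₃ then 1 else 0) + 0 ≡ 1ₚ w₀ w₁ w₃
    count-1ᵇ zero    zero    zero    = refl
    count-1ᵇ zero    zero    (suc _) = refl
    count-1ᵇ zero    (suc _) _       = refl
    count-1ᵇ (suc _) _       _       = refl

  countAccepted-suc : ∀ a p₃ p₂ p₁ m w₀ w₁ w₃ → countAccepted a p₃ p₂ p₁ (suc m) w₀ w₁ w₃ ≡
    sumBelow (λ x → if localCheck a p₃ p₂ p₁ x then weigh 0 a x (countAccepted (suc a) p₂ p₁ x m) w₀ w₁ w₃ else 0) n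
  countAccepted-suc a p₃ p₂ p₁ m w₀ w₁ w₃ =
    trans (count-concatMap _ (λ x → map (x ∷ᵥ_) (allVecs n m)) (allFin n))
          (trans (cong sum (map-cong first-entry (allFin n))) (sum-allFin n _))
    where
    first-entry : ∀ x → count (λ u → accepts a p₃ p₂ p₁ u w₀ w₁ w₃) (map (x ∷ᵥ_) (allVecs n m)) ≡
      (if localCheck a p₃ p₂ p₁ (toℕ x) then weigh 0 a (toℕ x) (countAccepted (suc a) p₂ p₁ (toℕ x) m) w₀ w₁ w₃ else 0)
    first-entry x = begin
      count _ (map (x ∷ᵥ_) (allVecs n m))
        ≡⟨ count-map _ (x ∷ᵥ_) (allVecs n m) ⟩
      count (λ u → c ∧ weigh false a (toℕ x) (accepts (suc a) p₂ p₁ (toℕ x) u) w₀ w₁ w₃) (allVecs n m)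
        ≡⟨ count-∧ c _ (allVecs n m) ⟩
      (if c then count (λ u → weigh false a (toℕ x) (accepts (suc a) p₂ p₁ (toℕ x) u) w₀ w₁ w₃) (allVecs n m) else 0)
        ≡⟨ cong (if c then_else 0) count-weigh ⟩
      (if c then weigh 0 a (toℕ x) (countAccepted (suc a) p₂ p₁ (toℕ x) m) w₀ w₁ w₃ else 0) ∎
      where
      open ≡-Reasoning
      c = localCheck a p₃ p₂ p₁ (toℕ x)
      count-weigh : count (λ u → weigh false a (toℕ x) (accepts (suc a) p₂ p₁ (toℕ x) u) w₀ w₁ w₃) (allVecs n m)
                  ≡ weigh 0 a (toℕ x) (countAccepted (suc a) p₂ p₁ (toℕ x) m) w₀ w₁ w₃
      count-weigh with inAᵇ a
      ... | true  = count-shiftBy (a + toℕ x ∸ n) (accepts (suc a) p₂ p₁ (toℕ x)) (allVecs n m) w₀ w₁ w₃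
      ... | false = refl

inAᵇ-≥4 : ∀ t → 4 ≤ t → inAᵇ t ≡ true
inAᵇ-≥4 (suc (suc (suc (suc t)))) _ = refl
inAᵇ-≥4 (suc zero)             (s≤s ())
inAᵇ-≥4 (suc (suc zero))       (s≤s (s≤s ()))
inAᵇ-≥4 (suc (suc (suc zero))) (s≤s (s≤s (s≤s ())))

shiftBy-cong : ∀ d {f g} → f ≈ₚ g → shiftBy 0 d f ≈ₚ shiftBy 0 d g
shiftBy-cong 0 = ·-cong c₀
shiftBy-cong 1 = ·-cong c₁
shiftBy-cong 2 _ _ _ _ = refl
shiftBy-cong 3 = ·-cong c₃
shiftBy-cong (suc (suc (suc (suc _)))) _ _ _ _ = refl

m≢j+m : ∀ m j → m ≢ suc (j + m)
m≢j+m m j = <⇒≢ (s≤s (m≤n+m m j))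

c+m≢ : ∀ {c d} m → c ≢ d → c + m ≢ d + m
c+m≢ m c≢d = c≢d ∘ +-cancelʳ-≡ m _ _

module Tail (n : ℕ) ⦃ _ : NonZero n ⦄ where
  open Automaton n

  Valid : ℕ → ℕ → ℕ → ℕ → Set
  Valid j a p m = inAᵇ (a ∸ j) ≡ true → p ≡ j + m ⊎ p ≡ suc (j + m) ⊎ p ≡ 3 + (j + m)

  hits-valid : ∀ j a p m c → Valid j a p m → c ≢ j → c ≢ suc j → c ≢ 3 + j → hits j a p (c + m) ≡ false
  hits-valid j a p m c valid c≢j c≢1+j c≢3+j with inAᵇ (a ∸ j) in inA
  ... | false = refl
  ... | true with valid refl
  ...   | inj₁ refl        = ≢⇒≡ᵇ≡false (≢-sym (c+m≢ m c≢j))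
  ...   | inj₂ (inj₁ refl) = ≢⇒≡ᵇ≡false (≢-sym (c+m≢ m c≢1+j))
  ...   | inj₂ (inj₂ refl) = ≢⇒≡ᵇ≡false (λ e → c+m≢ m c≢3+j (sym (trans (+-assoc 3 j m) e)))

  -- the flags h₃, h₂, h₁ of tailGF at position a
  covered₃ : ℕ → ℕ → ℕ → ℕ → Bool
  covered₃ a m p₃ p₂ = coveredBefore a p₃ p₂ (3 + m)

  covered₂ : ℕ → ℕ → ℕ → ℕ → Bool
  covered₂ a m p₂ p₁ = hits 1 a p₁ (2 + m) ∨ hits 2 a p₂ (2 + m)

  covered₁ : ℕ → ℕ → ℕ → Bool
  covered₁ a m p₁ = hits 1 a p₁ (1 + m)

  module Step (a m′ p₃ p₂ p₁ : ℕ) (a+m≡n : a + suc m′ ≡ n) (4≤a : 4 ≤ a)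
    (V₁ : Valid 1 a p₁ (suc m′)) (V₂ : Valid 2 a p₂ (suc m′)) (V₃ : Valid 3 a p₃ (suc m′)) where

    m = suc m′
    h₃ = covered₃ a m p₃ p₂
    h₂ = covered₂ a m p₂ p₁
    h₁ = covered₁ a m p₁

    a∈A : inAᵇ a ≡ true
    a∈A = inAᵇ-≥4 a 4≤a

    a+[d+m]≡d+n : ∀ d → a + (d + m) ≡ d + n
    a+[d+m]≡d+n d = trans (sym (+-assoc a d m)) (trans (cong (_+ m) (+-comm a d)) (trans (+-assoc d a m) (cong (d +_) a+m≡n)))

    sumOK-target : ∀ d → d ≡ 0 ⊎ d ≡ 1 ⊎ d ≡ 3 → sumOK a (d + m) ≡ true
    sumOK-target d d∈ = Equivalence.to T-≡ (Equivalence.from T-∨ (target d∈))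
      where
      target : d ≡ 0 ⊎ d ≡ 1 ⊎ d ≡ 3 →
        T (a + (d + m) ≡ᵇ n) ⊎ T ((a + (d + m) ≡ᵇ 1 + n) ∨ (a + (d + m) ≡ᵇ 3 + n))
      target (inj₁ refl)        = inj₁ (≡⇒≡ᵇ _ _ (a+[d+m]≡d+n 0))
      target (inj₂ (inj₁ refl)) = inj₂ (Equivalence.from T-∨ (inj₁ (≡⇒≡ᵇ _ _ (a+[d+m]≡d+n 1))))
      target (inj₂ (inj₂ refl)) = inj₂ (Equivalence.from T-∨ (inj₂ (≡⇒≡ᵇ _ _ (a+[d+m]≡d+n 3))))

    n+3∸a≡3+m : n + 3 ∸ a ≡ 3 + m
    n+3∸a≡3+m = trans (cong (_∸ a) (trans (cong (_+ 3) (sym a+m≡n)) (trans (+-assoc a m 3) (cong (a +_) (+-comm m 3)))))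
                      (m+n∸m≡n a (3 + m))

    covered-eval : ∀ x → covered a p₃ p₂ x ≡ (not (inBᵇ (3 + m)) ∨ h₃) ∨ (x ≡ᵇ 3 + m)
    covered-eval x = cong₂ (λ t b → not t ∨ coveredAt a p₃ p₂ x b) (Equivalence.to T-≡ (≤⇒≤ᵇ 4≤a)) n+3∸a≡3+m

    localCheck-eval : ∀ x → localCheck a p₃ p₂ p₁ x ≡ inBᵇ x ∧ (sumOK a x ∧ (fresh a p₃ p₂ p₁ x ∧ covered a p₃ p₂ x))
    localCheck-eval x = cong (λ i → if i then admissible a p₃ p₂ p₁ x else (x ≡ᵇ a)) a∈A

    private
      Y = not (inBᵇ (3 + m)) ∨ h₃

    fresh-m : fresh a p₃ p₂ p₁ m ≡ true
    fresh-m = cong not (cong₂ _∨_ (hits-valid 1 a p₁ m 0 V₁ (λ ()) (λ ()) (λ ()))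
                                  (cong₂ _∨_ (hits-valid 2 a p₂ m 0 V₂ (λ ()) (λ ()) (λ ()))
                                             (hits-valid 3 a p₃ m 0 V₃ (λ ()) (λ ()) (λ ()))))

    fresh-1+m : fresh a p₃ p₂ p₁ (1 + m) ≡ not h₁
    fresh-1+m = cong not (trans (cong (h₁ ∨_) (cong₂ _∨_ (hits-valid 2 a p₂ m 1 V₂ (λ ()) (λ ()) (λ ()))
                                                         (hits-valid 3 a p₃ m 1 V₃ (λ ()) (λ ()) (λ ()))))
                                (∨-identityʳ h₁))

    fresh-3+m : fresh a p₃ p₂ p₁ (3 + m) ≡ not h₃
    fresh-3+m = cong (λ t → not (t ∨ h₃)) (hits-valid 1 a p₁ m 3 V₁ (λ ()) (λ ()) (λ ()))

    localCheck-m : localCheck a p₃ p₂ p₁ m ≡ allow₀ m h₃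
    localCheck-m = begin
      localCheck a p₃ p₂ p₁ m
        ≡⟨ localCheck-eval m ⟩
      inBᵇ m ∧ (sumOK a m ∧ (fresh a p₃ p₂ p₁ m ∧ covered a p₃ p₂ m))
        ≡⟨ cong₂ (λ s c → inBᵇ m ∧ (s ∧ c)) (sumOK-target 0 (inj₁ refl)) (cong₂ _∧_ fresh-m (covered-eval m)) ⟩
      inBᵇ m ∧ (Y ∨ (m ≡ᵇ 3 + m))
        ≡⟨ cong (λ t → inBᵇ m ∧ (Y ∨ t)) (≢⇒≡ᵇ≡false (m≢j+m m 2)) ⟩
      inBᵇ m ∧ (Y ∨ false)
        ≡⟨ cong (inBᵇ m ∧_) (∨-identityʳ Y) ⟩
      inBᵇ m ∧ Y
        ≡⟨ ∧-comm (inBᵇ m) Y ⟩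
      Y ∧ inBᵇ m ∎
      where open ≡-Reasoning

    localCheck-1+m : localCheck a p₃ p₂ p₁ (1 + m) ≡ allow₁ m h₃ h₁
    localCheck-1+m = begin
      localCheck a p₃ p₂ p₁ (1 + m)
        ≡⟨ localCheck-eval (1 + m) ⟩
      X ∧ (sumOK a (1 + m) ∧ (fresh a p₃ p₂ p₁ (1 + m) ∧ covered a p₃ p₂ (1 + m)))
        ≡⟨ cong₂ (λ s c → X ∧ (s ∧ c)) (sumOK-target 1 (inj₂ (inj₁ refl))) (cong₂ _∧_ fresh-1+m (covered-eval (1 + m))) ⟩
      X ∧ (not h₁ ∧ (Y ∨ (1 + m ≡ᵇ 3 + m)))
        ≡⟨ cong (λ t → X ∧ (not h₁ ∧ t)) (trans (cong (Y ∨_) (≢⇒≡ᵇ≡false (c+m≢ {1} {3} m λ ()))) (∨-identityʳ Y)) ⟩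
      X ∧ (not h₁ ∧ Y)
        ≡⟨ ∧-assoc X (not h₁) Y ⟨
      (X ∧ not h₁) ∧ Y
        ≡⟨ ∧-comm (X ∧ not h₁) Y ⟩
      Y ∧ (X ∧ not h₁)
        ≡⟨ cong (Y ∧_) (∧-comm X (not h₁)) ⟩
      Y ∧ (not h₁ ∧ X) ∎
      where
      open ≡-Reasoning
      X = inBᵇ (1 + m)

    localCheck-3+m : localCheck a p₃ p₂ p₁ (3 + m) ≡ allow₃ m h₃
    localCheck-3+m = begin
      localCheck a p₃ p₂ p₁ (3 + m)
        ≡⟨ localCheck-eval (3 + m) ⟩
      X ∧ (sumOK a (3 + m) ∧ (fresh a p₃ p₂ p₁ (3 + m) ∧ covered a p₃ p₂ (3 + m)))
        ≡⟨ cong₂ (λ s c → X ∧ (s ∧ c)) (sumOK-target 3 (inj₂ (inj₂ refl))) (cong₂ _∧_ fresh-3+m (covered-eval (3 + m))) ⟩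
      X ∧ (not h₃ ∧ (Y ∨ (3 + m ≡ᵇ 3 + m)))
        ≡⟨ cong (λ t → X ∧ (not h₃ ∧ t)) (trans (cong (Y ∨_) (≡⇒≡ᵇ≡true {3 + m} refl)) (∨-zeroʳ Y)) ⟩
      X ∧ (not h₃ ∧ true)
        ≡⟨ cong (X ∧_) (∧-identityʳ (not h₃)) ⟩
      X ∧ not h₃
        ≡⟨ ∧-comm X (not h₃) ⟩
      not h₃ ∧ X ∎
      where
      open ≡-Reasoning
      X = inBᵇ (3 + m)

    localCheck⇒target : ∀ x → localCheck a p₃ p₂ p₁ x ≡ true → x ≡ m ⊎ x ≡ 1 + m ⊎ x ≡ 3 + m
    localCheck⇒target x ok with sumOK⇒ a x (admissible⇒sumOK a p₃ p₂ p₁ x (trans (sym (localCheck-eval x)) ok))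
    ... | inj₁ e        = inj₁ (+-cancelˡ-≡ a x m (trans e (sym a+m≡n)))
    ... | inj₂ (inj₁ e) = inj₂ (inj₁ (+-cancelˡ-≡ a x (1 + m) (trans e (sym (a+[d+m]≡d+n 1)))))
    ... | inj₂ (inj₂ e) = inj₂ (inj₂ (+-cancelˡ-≡ a x (3 + m) (trans e (sym (a+[d+m]≡d+n 3)))))

    weigh-at : ∀ d (F : Poly) → weigh 0 a (d + m) F ≡ shiftBy 0 d F
    weigh-at d F = cong₂ (λ i e → if i then shiftBy 0 e F else F) a∈A
                         (trans (cong (_∸ n) (a+[d+m]≡d+n d)) (m+n∸n≡m d n))

    covered₂-next : ∀ x → covered₂ (suc a) m′ p₁ x ≡ (x ≡ᵇ 1 + m) ∨ h₁
    covered₂-next x = cong (λ i → (i ∧ (x ≡ᵇ 1 + m)) ∨ h₁) a∈A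

    covered₁-next : ∀ x → covered₁ (suc a) m′ x ≡ (x ≡ᵇ m)
    covered₁-next x = cong (λ i → i ∧ (x ≡ᵇ m)) a∈A

    3+m<n : 3 + m < n
    3+m<n = subst (3 + m <_) a+m≡n (+-monoˡ-≤ m 4≤a)

    1+m<n : 1 + m < n
    1+m<n = <-trans (n<1+n (1 + m)) (<-trans (n<1+n (2 + m)) 3+m<n)

    next₂-m : covered₂ (suc a) m′ p₁ m ≡ h₁
    next₂-m = trans (covered₂-next m) (cong (_∨ h₁) (≢⇒≡ᵇ≡false (m≢j+m m 0)))

    next₁-m : covered₁ (suc a) m′ m ≡ true
    next₁-m = trans (covered₁-next m) (≡⇒≡ᵇ≡true {m} refl)

    next₂-1+m : covered₂ (suc a) m′ p₁ (1 + m) ≡ true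
    next₂-1+m = trans (covered₂-next (1 + m)) (cong (_∨ h₁) (≡⇒≡ᵇ≡true {1 + m} refl))

    next₁-1+m : covered₁ (suc a) m′ (1 + m) ≡ false
    next₁-1+m = trans (covered₁-next (1 + m)) (≢⇒≡ᵇ≡false (≢-sym (m≢j+m m 0)))

    next₂-3+m : covered₂ (suc a) m′ p₁ (3 + m) ≡ h₁
    next₂-3+m = trans (covered₂-next (3 + m)) (cong (_∨ h₁) (≢⇒≡ᵇ≡false (c+m≢ {3} {1} m λ ())))

    next₁-3+m : covered₁ (suc a) m′ (3 + m) ≡ false
    next₁-3+m = trans (covered₁-next (3 + m)) (≢⇒≡ᵇ≡false (≢-sym (m≢j+m m 2)))

  countAccepted-tail : 7 ≤ n → ∀ m a p₃ p₂ p₁ → a + m ≡ n → 4 ≤ a →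
    Valid 1 a p₁ m → Valid 2 a p₂ m → Valid 3 a p₃ m →
    countAccepted a p₃ p₂ p₁ m ≈ₚ tailGF m (covered₃ a m p₃ p₂) (covered₂ a m p₂ p₁) (covered₁ a m p₁)
  countAccepted-tail 7≤n zero a p₃ p₂ p₁ a+0≡n _ _ _ _ =
    ≈ₚ-trans (countAccepted-zero a p₃ p₂ p₁)
             (λ w₀ w₁ w₃ → cong (λ b → (if b then 1ₚ else 0ₚ) w₀ w₁ w₃) (final≡ (inA 1 (s≤s z≤n)) (inA 2 (s≤s (s≤s z≤n))) (inA 3 ≤-refl)))
    where
    7≤a : 7 ≤ a
    7≤a = subst (7 ≤_) (trans (sym a+0≡n) (+-identityʳ a)) 7≤n
    inA : ∀ j → j ≤ 3 → inAᵇ (a ∸ j) ≡ true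
    inA j j≤3 = inAᵇ-≥4 (a ∸ j) (≤-trans (∸-monoʳ-≤ 7 j≤3) (∸-monoˡ-≤ j 7≤a))
    final≡ : ∀ {i₁ i₂ i₃} → i₁ ≡ true → i₂ ≡ true → i₃ ≡ true →
      finalCheck p₃ p₂ p₁ ≡ ((i₂ ∧ (p₂ ≡ᵇ 3)) ∨ (i₃ ∧ (p₃ ≡ᵇ 3))) ∧ ((i₁ ∧ (p₁ ≡ᵇ 2)) ∨ (i₂ ∧ (p₂ ≡ᵇ 2)))
    final≡ refl refl refl = refl
  countAccepted-tail 7≤n (suc m′) a p₃ p₂ p₁ a+m≡n 4≤a V₁ V₂ V₃ w₀ w₁ w₃ = begin
    countAccepted a p₃ p₂ p₁ m w₀ w₁ w₃
      ≡⟨ countAccepted-suc a p₃ p₂ p₁ m′ w₀ w₁ w₃ ⟩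
    sumBelow term n
      ≡⟨ sumBelow-three-points (localCheck a p₃ p₂ p₁) value m (1 + m) (3 + m) n
           (m≢j+m m 0) (m≢j+m m 2) (c+m≢ {1} {3} m λ ()) (λ x _ → localCheck⇒target x) ⟩
    sumBelow (atPoint m (term m)) n + sumBelow (atPoint (1 + m) (term (1 + m))) n + sumBelow (atPoint (3 + m) (term (3 + m))) n
      ≡⟨ cong₂ _+_ (cong₂ _+_ (sumBelow-atPoint {m} _ (<-trans (n<1+n m) 1+m<n)) (sumBelow-atPoint {1 + m} _ 1+m<n)) (sumBelow-atPoint {3 + m} _ 3+m<n) ⟩
    term m + term (1 + m) + term (3 + m)
      ≡⟨ cong₂ _+_ (cong₂ _+_ (branch 0 localCheck-m (next-position m (λ _ → inj₁ refl) next₂-m next₁-m))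
                              (branch 1 localCheck-1+m (next-position (1 + m) (λ _ → inj₂ (inj₁ refl)) next₂-1+m next₁-1+m)))
                   (branch 3 localCheck-3+m (next-position (3 + m) (λ _ → inj₂ (inj₂ refl)) next₂-3+m next₁-3+m)) ⟩
    tailGF m h₃ h₂ h₁ w₀ w₁ w₃ ∎
    where
    open Step a m′ p₃ p₂ p₁ a+m≡n 4≤a V₁ V₂ V₃
    open ≡-Reasoning

    value : ℕ → ℕ
    value x = weigh 0 a x (countAccepted (suc a) p₂ p₁ x m′) w₀ w₁ w₃

    term : ℕ → ℕ
    term x = if localCheck a p₃ p₂ p₁ x then value x else 0

    next-position : ∀ x {h₂′ h₁′} → Valid 1 (suc a) x m′ → covered₂ (suc a) m′ p₁ x ≡ h₂′ → covered₁ (suc a) m′ x ≡ h₁′ →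
      countAccepted (suc a) p₂ p₁ x m′ ≈ₚ tailGF m′ h₂ h₂′ h₁′
    next-position x valid refl refl =
      countAccepted-tail 7≤n m′ (suc a) p₂ p₁ x (trans (sym (+-suc a m′)) a+m≡n) (≤-trans 4≤a (n≤1+n a)) valid V₁ V₂

    branch : ∀ d {guard G} → localCheck a p₃ p₂ p₁ (d + m) ≡ guard → countAccepted (suc a) p₂ p₁ (d + m) m′ ≈ₚ G →
      term (d + m) ≡ (if guard then shiftBy 0 d G else 0ₚ) w₀ w₁ w₃
    branch d {guard} check IH rewrite check with guard
    ... | true  = trans (cong (λ F → F w₀ w₁ w₃) (weigh-at d _)) (shiftBy-cong d IH w₀ w₁ w₃)
    ... | false = refl

  countAccepted-outsideA : ∀ a p₃ p₂ p₁ m → inAᵇ a ≡ false → a < n →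
    countAccepted a p₃ p₂ p₁ (suc m) ≈ₚ countAccepted (suc a) p₂ p₁ a m
  countAccepted-outsideA a p₃ p₂ p₁ m a∉A a<n w₀ w₁ w₃ =
    trans (countAccepted-suc a p₃ p₂ p₁ m w₀ w₁ w₃)
          (trans (sumBelow-one-point (localCheck a p₃ p₂ p₁) value a n a<n support) term-a)
    where
    check : ∀ x → localCheck a p₃ p₂ p₁ x ≡ (x ≡ᵇ a)
    check x = cong (λ i → if i then admissible a p₃ p₂ p₁ x else (x ≡ᵇ a)) a∉A
    value : ℕ → ℕ
    value x = weigh 0 a x (countAccepted (suc a) p₂ p₁ x m) w₀ w₁ w₃
    support : ∀ x → x < n → localCheck a p₃ p₂ p₁ x ≡ true → x ≡ a
    support x _ ok = ≡ᵇ≡true⇒≡ (trans (sym (check x)) ok)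
    term-a : (if localCheck a p₃ p₂ p₁ a then value a else 0) ≡ countAccepted (suc a) p₂ p₁ a m w₀ w₁ w₃
    term-a rewrite check a | ≡⇒≡ᵇ≡true {a} refl | a∉A = refl

module Head (i : ℕ) where
  open Automaton (10 + i)
  open Tail (10 + i)

  private
    N = 10 + i

  -- position 2 is sent to 8 + i or 9 + i (its third target 11 + i is out of range)
  countAccepted-2 : countAccepted 2 0 0 1 (8 + i) ≈ₚ
    c₀ · countAccepted 3 0 1 (8 + i) (7 + i) +ₚ c₁ · countAccepted 3 0 1 (9 + i) (7 + i)
  countAccepted-2 w₀ w₁ w₃ = begin
    countAccepted 2 0 0 1 (8 + i) w₀ w₁ w₃
      ≡⟨ countAccepted-suc 2 0 0 1 (7 + i) w₀ w₁ w₃ ⟩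
    sumBelow term N
      ≡⟨ sumBelow-three-points (localCheck 2 0 0 1) value (8 + i) (9 + i) (11 + i) N
           (m≢j+m (8 + i) 0) (m≢j+m (8 + i) 2) (c+m≢ {9} {11} i λ ()) support ⟩
    sumBelow (atPoint (8 + i) (term (8 + i))) N + sumBelow (atPoint (9 + i) (term (9 + i))) N + sumBelow (atPoint (11 + i) (term (11 + i))) N
      ≡⟨ cong₂ _+_ (cong₂ _+_ (sumBelow-atPoint {8 + i} _ (<-trans (n<1+n (8 + i)) (n<1+n (9 + i)))) (sumBelow-atPoint {9 + i} _ ≤-refl))
                   (sumBelow-atPoint-≥ {11 + i} _ (n≤1+n N)) ⟩
    term (8 + i) + term (9 + i) + 0
      ≡⟨ +-identityʳ _ ⟩
    term (8 + i) + term (9 + i)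
      ≡⟨ cong₂ _+_ (branch 0 check-8) (branch 1 check-9) ⟩
    (c₀ · countAccepted 3 0 1 (8 + i) (7 + i) +ₚ c₁ · countAccepted 3 0 1 (9 + i) (7 + i)) w₀ w₁ w₃ ∎
    where
    open ≡-Reasoning
    value : ℕ → ℕ
    value x = weigh 0 2 x (countAccepted 3 0 1 x (7 + i)) w₀ w₁ w₃

    term : ℕ → ℕ
    term x = if localCheck 2 0 0 1 x then value x else 0

    support : ∀ x → x < N → localCheck 2 0 0 1 x ≡ true → x ≡ 8 + i ⊎ x ≡ 9 + i ⊎ x ≡ 11 + i
    support x _ ok with sumOK⇒ 2 x (admissible⇒sumOK 2 0 0 1 x ok)
    ... | inj₁ e        = inj₁ (+-cancelˡ-≡ 2 x (8 + i) e)
    ... | inj₂ (inj₁ e) = inj₂ (inj₁ (+-cancelˡ-≡ 2 x (9 + i) e))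
    ... | inj₂ (inj₂ e) = inj₂ (inj₂ (+-cancelˡ-≡ 2 x (11 + i) e))

    -- at position 2 only sumOK is not immediate
    check-8 : localCheck 2 0 0 1 (8 + i) ≡ true
    check-8 = cong (_∧ true) (∨-≡trueˡ ((10 + i ≡ᵇ 1 + N) ∨ (10 + i ≡ᵇ 3 + N)) (≡⇒≡ᵇ≡true {10 + i} {N} refl))
    check-9 : localCheck 2 0 0 1 (9 + i) ≡ true
    check-9 = cong (_∧ true) (∨-≡trueʳ (11 + i ≡ᵇ N) (∨-≡trueˡ (11 + i ≡ᵇ 3 + N) (≡⇒≡ᵇ≡true {11 + i} {1 + N} refl)))

    branch : ∀ d → localCheck 2 0 0 1 (8 + d + i) ≡ true →
      term (8 + d + i) ≡ shiftBy 0 d (countAccepted 3 0 1 (8 + d + i) (7 + i)) w₀ w₁ w₃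
    branch d check = trans (cong (λ b → if b then weigh 0 2 (8 + d + i) F w₀ w₁ w₃ else 0) check)
                           (cong (λ e → shiftBy 0 e F w₀ w₁ w₃) (m+n∸n≡m d i))
      where F = countAccepted 3 0 1 (8 + d + i) (7 + i)

  -- position 3 ∉ A, after which the state at position 4 is (1, x, 3)
  countAccepted-3 : ∀ x → x ≡ 8 + i ⊎ x ≡ 9 + i →
    countAccepted 3 0 1 x (7 + i) ≈ₚ tailGF (6 + i) ((x ≡ᵇ 9 + i) ∨ false) (x ≡ᵇ 8 + i) false
  countAccepted-3 x x∈ =
    ≈ₚ-trans (countAccepted-outsideA 3 0 1 x (6 + i) refl (s≤s (s≤s (s≤s (s≤s z≤n)))))
             (countAccepted-tail (≤-trans (m≤m+n 7 3) (m≤m+n 10 i))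
                (6 + i) 4 1 x 3 refl ≤-refl (λ ()) (λ _ → valid x∈) (λ ()))
    where
    valid : x ≡ 8 + i ⊎ x ≡ 9 + i → x ≡ 8 + i ⊎ x ≡ 9 + i ⊎ x ≡ 11 + i
    valid (inj₁ e) = inj₁ e
    valid (inj₂ e) = inj₂ (inj₁ e)

  countAccepted≈matchingPoly : countAccepted 0 0 0 0 N ≈ₚ matchingPoly i
  countAccepted≈matchingPoly = begin
    countAccepted 0 0 0 0 N
      ≈⟨ countAccepted-outsideA 0 0 0 0 (9 + i) refl (s≤s z≤n) ⟩
    countAccepted 1 0 0 0 (9 + i)
      ≈⟨ countAccepted-outsideA 1 0 0 0 (8 + i) refl (s≤s (s≤s z≤n)) ⟩
    countAccepted 2 0 0 1 (8 + i)
      ≈⟨ countAccepted-2 ⟩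
    c₀ · countAccepted 3 0 1 (8 + i) (7 + i) +ₚ c₁ · countAccepted 3 0 1 (9 + i) (7 + i)
      ≈⟨ +ₚ-cong (·-cong c₀ (≈ₚ-trans (countAccepted-3 (8 + i) (inj₁ refl)) (flags 8≢9 (≡⇒≡ᵇ≡true {8 + i} refl))))
                 (·-cong c₁ (≈ₚ-trans (countAccepted-3 (9 + i) (inj₂ refl)) (flags (cong (_∨ false) (≡⇒≡ᵇ≡true {9 + i} refl)) 9≢8))) ⟩
    matchingPoly i ∎
    where
    open ≈ₚ-Reasoning
    8≢9 : (8 + i ≡ᵇ 9 + i) ∨ false ≡ false
    8≢9 = cong (_∨ false) (≢⇒≡ᵇ≡false (m≢j+m (8 + i) 0))
    9≢8 : (9 + i ≡ᵇ 8 + i) ≡ false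
    9≢8 = ≢⇒≡ᵇ≡false (≢-sym (m≢j+m (8 + i) 0))
    flags : ∀ {u u′ v v′} → u ≡ u′ → v ≡ v′ → tailGF (6 + i) u v false ≈ₚ tailGF (6 + i) u′ v′ false
    flags refl refl = ≈ₚ-refl

-- Matchings as value sequences

module Values (n : ℕ) ⦃ _ : NonZero n ⦄ where
  open Automaton n

  value : ∀ {m} → Vec (Fin n) m → ℕ → ℕ
  value []ᵥ       _       = 0
  value (x ∷ᵥ u) zero    = toℕ x
  value (x ∷ᵥ u) (suc i) = value u i

  value-lookup : ∀ {m} (u : Vec (Fin n) m) i → value u (toℕ i) ≡ toℕ (lookup u i)
  value-lookup (x ∷ᵥ u) fzero    = refl
  value-lookup (x ∷ᵥ u) (fsuc i) = value-lookup u i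

  value<n : ∀ {m} (u : Vec (Fin n) m) i → i < m → value u i < n
  value<n (x ∷ᵥ u) zero    _         = toℕ<n x
  value<n (x ∷ᵥ u) (suc i) (s≤s i<m) = value<n u i i<m

  -- the conditions of Defs.IsMatching for the values V i = f(i) ∈ ℕ
  record Matching (V : ℕ → ℕ) : Set where
    field
      to-B       : ∀ i → i < n → inAᵇ i ≡ true → inBᵇ (V i) ≡ true
      sum-OK     : ∀ i → i < n → inAᵇ i ≡ true → sumOK i (V i) ≡ true
      injective  : ∀ i j → i < n → j < n → inAᵇ i ≡ true → inAᵇ j ≡ true → V i ≡ V j → i ≡ j
      onto-B     : ∀ b → b < n → inBᵇ b ≡ true → ∃ λ t → t < n × inAᵇ t ≡ true × V t ≡ b
      outside-A  : ∀ i → i < n → inAᵇ i ≡ false → V i ≡ i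

module Translation (n : ℕ) ⦃ _ : NonZero n ⦄ (7≤n : 7 ≤ n) where
  open Automaton n
  open Values n

  toℕ-[k]≡k : ∀ k → k < 7 → toℕ ([_] n k) ≡ k
  toℕ-[k]≡k k k<7 = trans (toℕ-fromℕ< _) (m<n⇒m%n≡m (≤-trans k<7 7≤n))

  does-≟ᶠ : ∀ (a b : Fin n) → does (a ≟ᶠ b) ≡ (toℕ a ≡ᵇ toℕ b)
  does-≟ᶠ a b = does-⇔ (mk⇔ (cong toℕ) toℕ-injective) (a ≟ᶠ b) (toℕ a ≟ toℕ b)

  de-Morgan₃ : ∀ p q r → not p ∧ (not q ∧ not r) ≡ not (p ∨ (q ∨ r))
  de-Morgan₃ true  _     _ = refl
  de-Morgan₃ false true  _ = refl
  de-Morgan₃ false false _ = refl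

  does-avoid : ∀ (a : Fin n) k₁ k₂ k₃ → k₁ < 7 → k₂ < 7 → k₃ < 7 →
    does (¬? (a ≟ᶠ [_] n k₁) ×-dec ¬? (a ≟ᶠ [_] n k₂) ×-dec ¬? (a ≟ᶠ [_] n k₃))
      ≡ not ((toℕ a ≡ᵇ k₁) ∨ (toℕ a ≡ᵇ k₂) ∨ (toℕ a ≡ᵇ k₃))
  does-avoid a k₁ k₂ k₃ k₁<7 k₂<7 k₃<7 = trans
    (cong₂ (λ p q → not p ∧ q) (eq k₁ k₁<7) (cong₂ (λ p q → not p ∧ not q) (eq k₂ k₂<7) (eq k₃ k₃<7)))
    (de-Morgan₃ (toℕ a ≡ᵇ k₁) (toℕ a ≡ᵇ k₂) (toℕ a ≡ᵇ k₃))
    where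
    eq : ∀ k → k < 7 → does (a ≟ᶠ [_] n k) ≡ (toℕ a ≡ᵇ k)
    eq k k<7 = trans (does-≟ᶠ a ([_] n k)) (cong (toℕ a ≡ᵇ_) (toℕ-[k]≡k k k<7))

  does-inA? : ∀ a → does (inA? n a) ≡ inAᵇ (toℕ a)
  does-inA? a = does-avoid a 0 1 3 (s≤s z≤n) (s≤s (s≤s z≤n)) (s≤s (s≤s (s≤s (s≤s z≤n))))

  does-inB? : ∀ a → does (inB? n a) ≡ inBᵇ (toℕ a)
  does-inB? a = does-avoid a 0 1 6 (s≤s z≤n) (s≤s (s≤s z≤n)) ≤-refl

  InA⇒ : ∀ a → InA n a → inAᵇ (toℕ a) ≡ true
  InA⇒ a a∈A = trans (sym (does-inA? a)) (dec-true (inA? n a) a∈A)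

  ⇒InA : ∀ a → inAᵇ (toℕ a) ≡ true → InA n a
  ⇒InA a e = does≡true⇒ (inA? n a) (trans (does-inA? a) e)

  ∉A⇒ : ∀ a → ¬ InA n a → inAᵇ (toℕ a) ≡ false
  ∉A⇒ a a∉A = trans (sym (does-inA? a)) (dec-false (inA? n a) a∉A)

  ⇒∉A : ∀ a → inAᵇ (toℕ a) ≡ false → ¬ InA n a
  ⇒∉A a e a∈A = contradiction (trans (sym (InA⇒ a a∈A)) e) λ ()

  InB⇒ : ∀ b → InB n b → inBᵇ (toℕ b) ≡ true
  InB⇒ b b∈B = trans (sym (does-inB? b)) (dec-true (inB? n b) b∈B)

  ⇒InB : ∀ b → inBᵇ (toℕ b) ≡ true → InB n b
  ⇒InB b e = does≡true⇒ (inB? n b) (trans (does-inB? b) e)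

  ≡ᵇ-+ʳ : ∀ x d → (x + n ≡ᵇ d + n) ≡ (x ≡ᵇ d)
  ≡ᵇ-+ʳ x d = trans (cong₂ _≡ᵇ_ (+-comm x n) (+-comm d n)) (cancel n)
    where
    cancel : ∀ k → (k + x ≡ᵇ k + d) ≡ (x ≡ᵇ d)
    cancel zero    = refl
    cancel (suc k) = cancel k

  %-wrap : ∀ s → n ≤ s → s < n + n → s % n ≡ s ∸ n
  %-wrap s n≤s s<2n = trans (sym (m≤n⇒[n∸m]%m≡n%m n≤s))
    (m<n⇒m%n≡m (+-cancelʳ-< n (s ∸ n) n (subst (_< n + n) (sym (m∸n+n≡m n≤s)) s<2n)))

  -- for a + x ≥ 4, the sum lies in A unless it wraps around to 0, 1 or 3
  sumOK-mod : ∀ a x → a < n → x < n → 4 ≤ a + x → sumOK a x ≡ not (inAᵇ ((a + x) % n))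
  sumOK-mod a x a<n x<n 4≤s with n ≤? a + x
  ... | yes n≤s = begin
    sumOK a x
      ≡⟨ cong (λ t → (t ≡ᵇ 0 + n) ∨ (t ≡ᵇ 1 + n) ∨ (t ≡ᵇ 3 + n)) (sym (m∸n+n≡m n≤s)) ⟩
    (r + n ≡ᵇ 0 + n) ∨ (r + n ≡ᵇ 1 + n) ∨ (r + n ≡ᵇ 3 + n)
      ≡⟨ cong₂ _∨_ (≡ᵇ-+ʳ r 0) (cong₂ _∨_ (≡ᵇ-+ʳ r 1) (≡ᵇ-+ʳ r 3)) ⟩
    (r ≡ᵇ 0) ∨ (r ≡ᵇ 1) ∨ (r ≡ᵇ 3)
      ≡⟨ not-involutive _ ⟨
    not (inAᵇ r)
      ≡⟨ cong (not ∘ inAᵇ) (%-wrap (a + x) n≤s (+-mono-< a<n x<n)) ⟨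
    not (inAᵇ ((a + x) % n)) ∎
    where
    open ≡-Reasoning
    r = a + x ∸ n
  ... | no  n≰s = begin
    sumOK a x
      ≡⟨ cong₂ _∨_ (≢⇒≡ᵇ≡false (<⇒≢ s<n)) (cong₂ _∨_ (≢⇒≡ᵇ≡false (<⇒≢ (<-trans s<n (n<1+n n))))
                                                    (≢⇒≡ᵇ≡false (<⇒≢ (≤-trans s<n (m≤n+m n 3))))) ⟩
    false
      ≡⟨ cong not (inAᵇ-≥4 (a + x) 4≤s) ⟨
    not (inAᵇ (a + x))
      ≡⟨ cong (not ∘ inAᵇ) (m<n⇒m%n≡m s<n) ⟨
    not (inAᵇ ((a + x) % n)) ∎
    where
    open ≡-Reasoning
    s<n : a + x < n
    s<n = ≰⇒> n≰s

  inAᵇ⇒2≤ : ∀ t → inAᵇ t ≡ true → 2 ≤ t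
  inAᵇ⇒2≤ (suc (suc t)) _ = s≤s (s≤s z≤n)

  inBᵇ⇒2≤ : ∀ t → inBᵇ t ≡ true → 2 ≤ t
  inBᵇ⇒2≤ (suc (suc t)) _ = s≤s (s≤s z≤n)

  module _ (v : Vec (Fin n) n) where
    toℕ-⊕ : ∀ a → toℕ (_⊕_ n a (lookup v a)) ≡ (toℕ a + value v (toℕ a)) % n
    toℕ-⊕ a = trans (toℕ-fromℕ< _) (cong (λ x → (toℕ a + x) % n) (sym (value-lookup v a)))

    private
      V = value v

      V-fromℕ< : ∀ {i} (i<n : i < n) → V i ≡ toℕ (lookup v (fromℕ< i<n))
      V-fromℕ< {i} i<n = trans (cong V (sym (toℕ-fromℕ< i<n))) (value-lookup v (fromℕ< i<n))

      InA-fromℕ< : ∀ {i} (i<n : i < n) → inAᵇ i ≡ true → InA n (fromℕ< i<n)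
      InA-fromℕ< i<n i∈A = ⇒InA _ (trans (cong inAᵇ (toℕ-fromℕ< i<n)) i∈A)

      sumOK-V : ∀ i → i < n → inAᵇ i ≡ true → inBᵇ (V i) ≡ true → sumOK i (V i) ≡ not (inAᵇ ((i + V i) % n))
      sumOK-V i i<n i∈A Vi∈B = sumOK-mod i (V i) i<n (value<n v i i<n) (+-mono-≤ (inAᵇ⇒2≤ i i∈A) (inBᵇ⇒2≤ (V i) Vi∈B))

    isMatching⇒ : IsMatching n v → Matching V
    isMatching⇒ (to-B , injective , onto , matching , normalised) = record
      { to-B = to-Bᵛ ; sum-OK = sum-OK ; injective = injectiveᵛ ; onto-B = onto-B ; outside-A = outside-A }
      where
      to-Bᵛ : ∀ i → i < n → inAᵇ i ≡ true → inBᵇ (V i) ≡ true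
      to-Bᵛ i i<n i∈A = trans (cong inBᵇ (V-fromℕ< i<n)) (InB⇒ _ (to-B _ (InA-fromℕ< i<n i∈A)))
      sum-OK : ∀ i → i < n → inAᵇ i ≡ true → sumOK i (V i) ≡ true
      sum-OK i i<n i∈A = trans (sumOK-V i i<n i∈A (to-Bᵛ i i<n i∈A)) (cong not (begin
        inAᵇ ((i + V i) % n)
          ≡⟨ cong (λ t → inAᵇ ((t + V t) % n)) (toℕ-fromℕ< i<n) ⟨
        inAᵇ ((toℕ a + V (toℕ a)) % n)
          ≡⟨ cong inAᵇ (toℕ-⊕ a) ⟨
        inAᵇ (toℕ (_⊕_ n a (lookup v a)))
          ≡⟨ ∉A⇒ _ (matching a (InA-fromℕ< i<n i∈A)) ⟩
        false ∎))
        where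
        open ≡-Reasoning
        a = fromℕ< i<n
      injectiveᵛ : ∀ i j → i < n → j < n → inAᵇ i ≡ true → inAᵇ j ≡ true → V i ≡ V j → i ≡ j
      injectiveᵛ i j i<n j<n i∈A j∈A Vi≡Vj =
        trans (sym (toℕ-fromℕ< i<n))
              (trans (cong toℕ (injective _ (InA-fromℕ< i<n i∈A) _ (InA-fromℕ< j<n j∈A)
                                  (toℕ-injective (trans (sym (V-fromℕ< i<n)) (trans Vi≡Vj (V-fromℕ< j<n))))))
                     (toℕ-fromℕ< j<n))
      onto-B : ∀ b → b < n → inBᵇ b ≡ true → ∃ λ t → t < n × inAᵇ t ≡ true × V t ≡ b
      onto-B b b<n b∈B with onto (fromℕ< b<n) (⇒InB _ (trans (cong inBᵇ (toℕ-fromℕ< b<n)) b∈B))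
      ... | a , a∈A , fa≡b = toℕ a , toℕ<n a , InA⇒ a a∈A , trans (value-lookup v a) (trans (cong toℕ fa≡b) (toℕ-fromℕ< b<n))
      outside-A : ∀ i → i < n → inAᵇ i ≡ false → V i ≡ i
      outside-A i i<n i∉A = trans (V-fromℕ< i<n) (trans (cong toℕ (normalised _ (⇒∉A _ (trans (cong inAᵇ (toℕ-fromℕ< i<n)) i∉A))))
                                                         (toℕ-fromℕ< i<n))

    ⇒isMatching : Matching V → IsMatching n v
    ⇒isMatching M = to-B′ , injective′ , onto′ , matching , normalised
      where
      open Matching M
      to-B′ : ∀ a → InA n a → InB n (lookup v a)
      to-B′ a a∈A = ⇒InB _ (trans (cong inBᵇ (sym (value-lookup v a))) (to-B (toℕ a) (toℕ<n a) (InA⇒ a a∈A)))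
      injective′ : ∀ a → InA n a → ∀ a′ → InA n a′ → lookup v a ≡ lookup v a′ → a ≡ a′
      injective′ a a∈A a′ a′∈A fa≡fa′ = toℕ-injective (injective (toℕ a) (toℕ a′) (toℕ<n a) (toℕ<n a′) (InA⇒ a a∈A) (InA⇒ a′ a′∈A)
        (trans (value-lookup v a) (trans (cong toℕ fa≡fa′) (sym (value-lookup v a′)))))
      onto′ : ∀ b → InB n b → ∃ λ a → InA n a × lookup v a ≡ b
      onto′ b b∈B with onto-B (toℕ b) (toℕ<n b) (InB⇒ b b∈B)
      ... | t , t<n , t∈A , Vt≡b = fromℕ< t<n , InA-fromℕ< t<n t∈A , toℕ-injective (trans (sym (V-fromℕ< t<n)) Vt≡b)
      matching : ∀ a → InA n a → ¬ InA n (_⊕_ n a (lookup v a))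
      matching a a∈A = ⇒∉A _ (begin
        inAᵇ (toℕ (_⊕_ n a (lookup v a))) ≡⟨ cong inAᵇ (toℕ-⊕ a) ⟩
        inAᵇ ((toℕ a + V (toℕ a)) % n)    ≡⟨ not-involutive _ ⟨
        not (not (inAᵇ ((toℕ a + V (toℕ a)) % n)))
          ≡⟨ cong not (trans (sym (sumOK-V (toℕ a) (toℕ<n a) i∈A (to-B (toℕ a) (toℕ<n a) i∈A))) (sum-OK (toℕ a) (toℕ<n a) i∈A)) ⟩
        false ∎)
        where
        open ≡-Reasoning
        i∈A = InA⇒ a a∈A
      normalised : ∀ a → ¬ InA n a → lookup v a ≡ a
      normalised a a∉A = toℕ-injective (trans (sym (value-lookup v a)) (outside-A (toℕ a) (toℕ<n a) (∉A⇒ a a∉A)))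

-- V preceded by p₃, p₂, p₁: position i of V sees the state
-- (prefixed V i, prefixed V (1 + i), prefixed V (2 + i))
prefixed : ℕ → ℕ → ℕ → (ℕ → ℕ) → ℕ → ℕ
prefixed p₃ p₂ p₁ V 0                   = p₃
prefixed p₃ p₂ p₁ V 1                   = p₂
prefixed p₃ p₂ p₁ V 2                   = p₁
prefixed p₃ p₂ p₁ V (suc (suc (suc i))) = V i

padded : (ℕ → ℕ) → ℕ → ℕ
padded = prefixed 0 0 0

module LocalChecks (n : ℕ) ⦃ _ : NonZero n ⦄ (10≤n : 10 ≤ n) where
  open Automaton n
  open Values n

  checkAt : (ℕ → ℕ) → ℕ → Bool
  checkAt V i = localCheck i (padded V i) (padded V (1 + i)) (padded V (2 + i)) (V i)

  k : ℕ
  k = n ∸ 3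

  n≡3+k : n ≡ 3 + k
  n≡3+k = sym (m+[n∸m]≡n (≤-trans (s≤s (s≤s (s≤s z≤n))) 10≤n))

  AllChecks : (ℕ → ℕ) → Set
  AllChecks V = (∀ i → i < n → checkAt V i ≡ true) × finalCheck (V k) (V (1 + k)) (V (2 + k)) ≡ true

  offset : ∀ t b i d → t + b ≡ d + n → b + i ≡ 3 + n → d + i ≡ 3 + t
  offset t b i d t+b≡d+n b+i≡3+n = +-cancelʳ-≡ n _ _ (begin
    d + i + n   ≡⟨ +-assoc d i n ⟩
    d + (i + n) ≡⟨ cong (d +_) (+-comm i n) ⟩
    d + (n + i) ≡⟨ +-assoc d n i ⟨
    d + n + i   ≡⟨ cong (_+ i) t+b≡d+n ⟨
    t + b + i   ≡⟨ +-assoc t b i ⟩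
    t + (b + i) ≡⟨ cong (t +_) b+i≡3+n ⟩
    t + (3 + n) ≡⟨ +-assoc t 3 n ⟨
    t + 3 + n   ≡⟨ cong (_+ n) (+-comm t 3) ⟩
    3 + t + n   ∎)
    where open ≡-Reasoning

  checkAt-A : ∀ V i → inAᵇ i ≡ true →
    checkAt V i ≡ admissible i (padded V i) (padded V (1 + i)) (padded V (2 + i)) (V i)
  checkAt-A V i i∈A = cong (λ b → if b then admissible i (padded V i) (padded V (1 + i)) (padded V (2 + i)) (V i) else (V i ≡ᵇ i)) i∈A

  checkAt-∉A : ∀ V i → inAᵇ i ≡ false → checkAt V i ≡ (V i ≡ᵇ i)
  checkAt-∉A V i i∉A = cong (λ b → if b then admissible i (padded V i) (padded V (1 + i)) (padded V (2 + i)) (V i) else (V i ≡ᵇ i)) i∉A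

  module FromMatching {V : ℕ → ℕ} (M : Matching V) where
    open Matching M

    no-collision : ∀ t i → t < i → i < n → inAᵇ i ≡ true → inAᵇ t ∧ (V t ≡ᵇ V i) ≡ false
    no-collision t i t<i i<n i∈A with inAᵇ t in t∈A
    ... | false = refl
    ... | true  = ≢⇒≡ᵇ≡false (<⇒≢ t<i ∘ injective t i (<-trans t<i i<n) i<n t∈A i∈A)

    hit₁ : ∀ i → i < n → inAᵇ i ≡ true → hits 1 i (padded V (2 + i)) (V i) ≡ false
    hit₁ zero    _   _   = refl
    hit₁ (suc t) i<n i∈A = no-collision t (1 + t) (n<1+n t) i<n i∈A

    hit₂ : ∀ i → i < n → inAᵇ i ≡ true → hits 2 i (padded V (1 + i)) (V i) ≡ false
    hit₂ zero          _   _   = refl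
    hit₂ (suc zero)    _   _   = refl
    hit₂ (suc (suc t)) i<n i∈A = no-collision t (2 + t) (m<n+m t z<s) i<n i∈A

    hit₃ : ∀ i → i < n → inAᵇ i ≡ true → hits 3 i (padded V i) (V i) ≡ false
    hit₃ zero                _   _   = refl
    hit₃ (suc zero)          _   _   = refl
    hit₃ (suc (suc zero))    _   _   = refl
    hit₃ (suc (suc (suc t))) i<n i∈A = no-collision t (3 + t) (m<n+m t z<s) i<n i∈A

    fresh-holds : ∀ i → i < n → inAᵇ i ≡ true → fresh i (padded V i) (padded V (1 + i)) (padded V (2 + i)) (V i) ≡ true
    fresh-holds i i<n i∈A = cong not (cong₂ _∨_ (hit₁ i i<n i∈A) (cong₂ _∨_ (hit₂ i i<n i∈A) (hit₃ i i<n i∈A)))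

    -- the target b = n + 3 − i, if in B, is hit by i − 3, i − 2 or i (according
    -- as its preimage t has t + b = n, n + 1 or n + 3)
    covered-holds : ∀ i → i < n → covered i (padded V i) (padded V (1 + i)) (V i) ≡ true
    covered-holds i i<n with 4 ≤? i
    ... | no 4≰i = cong (λ t → not t ∨ coveredAt i (padded V i) (padded V (1 + i)) (V i) (n + 3 ∸ i))
                        (¬-not (4≰i ∘ ≤ᵇ⇒≤ 4 i ∘ Equivalence.from T-≡))
    ... | yes 4≤i = trans (cong (λ t → not t ∨ coveredAt i p₃ p₂ (V i) b) (Equivalence.to T-≡ (≤⇒≤ᵇ 4≤i)))
                          (coveredAt-holds (inBᵇ b) refl)
      where
      p₃ = padded V i
      p₂ = padded V (1 + i)
      b = n + 3 ∸ i
      b+i≡3+n : b + i ≡ 3 + n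
      b+i≡3+n = trans (m∸n+n≡m (≤-trans (<⇒≤ i<n) (m≤m+n n 3))) (+-comm n 3)
      b<n : b < n
      b<n = +-cancelʳ-< i b n (subst (_< n + i) (trans (+-comm n 3) (sym b+i≡3+n)) (+-monoʳ-< n 4≤i))
      before : coveredBefore i p₃ p₂ b ≡ true → coveredAt i p₃ p₂ (V i) b ≡ true
      before h = ∨-≡trueˡ (V i ≡ᵇ b) (∨-≡trueʳ (not (inBᵇ b)) h)
      coveredAt-holds : ∀ B → inBᵇ b ≡ B → coveredAt i p₃ p₂ (V i) b ≡ true
      coveredAt-holds false b∉B = ∨-≡trueˡ (V i ≡ᵇ b) (∨-≡trueˡ (coveredBefore i p₃ p₂ b) (cong not b∉B))
      coveredAt-holds true  b∈B with onto-B b b<n b∈B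
      ... | t , t<n , t∈A , Vt≡b with sumOK⇒ t b (subst (λ x → sumOK t x ≡ true) Vt≡b (sum-OK t t<n t∈A))
      ...   | inj₁ e        = before (∨-≡trueʳ (hits 2 i p₂ b) (by₃ i (offset t b i 0 e b+i≡3+n)))
        where
        by₃ : ∀ i → i ≡ 3 + t → hits 3 i (padded V i) b ≡ true
        by₃ .(3 + t) refl = cong₂ _∧_ t∈A (≡⇒≡ᵇ≡true Vt≡b)
      ...   | inj₂ (inj₁ e) = before (∨-≡trueˡ (hits 3 i p₃ b) (by₂ i (suc-injective (offset t b i 1 e b+i≡3+n))))
        where
        by₂ : ∀ i → i ≡ 2 + t → hits 2 i (padded V (1 + i)) b ≡ true
        by₂ .(2 + t) refl = cong₂ _∧_ t∈A (≡⇒≡ᵇ≡true Vt≡b)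
      ...   | inj₂ (inj₂ e) = ∨-≡trueʳ (not (inBᵇ b) ∨ coveredBefore i p₃ p₂ b) (≡⇒≡ᵇ≡true (trans (cong V (+-cancelˡ-≡ 3 i t (offset t b i 3 e b+i≡3+n))) Vt≡b))

    checkAt-holds : ∀ i → i < n → checkAt V i ≡ true
    checkAt-holds i i<n = by-cases (inAᵇ i) refl
      where
      by-cases : ∀ b → inAᵇ i ≡ b → checkAt V i ≡ true
      by-cases true  i∈A = trans (checkAt-A V i i∈A)
        (cong₂ _∧_ (to-B i i<n i∈A) (cong₂ _∧_ (sum-OK i i<n i∈A) (cong₂ _∧_ (fresh-holds i i<n i∈A) (covered-holds i i<n))))
      by-cases false i∉A = trans (checkAt-∉A V i i∉A) (≡⇒≡ᵇ≡true (outside-A i i<n i∉A))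

    -- the targets 3 and 2 can only be reached from the last three positions
    final-holds : finalCheck (V k) (V (1 + k)) (V (2 + k)) ≡ true
    final-holds = cong₂ _∧_ target₃ target₂
      where
      3<n : 3 < n
      3<n = ≤-trans (s≤s (s≤s (s≤s (s≤s z≤n)))) 10≤n
      target₃ : (V (1 + k) ≡ᵇ 3) ∨ (V k ≡ᵇ 3) ≡ true
      target₃ with onto-B 3 3<n refl
      ... | t , t<n , t∈A , Vt≡3 with sumOK⇒ t 3 (subst (λ x → sumOK t x ≡ true) Vt≡3 (sum-OK t t<n t∈A))
      ...   | inj₁ e        = ∨-≡trueʳ (V (1 + k) ≡ᵇ 3) (≡⇒≡ᵇ≡true (subst (λ s → V s ≡ 3) (+-cancelʳ-≡ 3 t k (trans e (trans n≡3+k (+-comm 3 k)))) Vt≡3))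
      ...   | inj₂ (inj₁ e) = ∨-≡trueˡ (V k ≡ᵇ 3) (≡⇒≡ᵇ≡true (subst (λ s → V s ≡ 3) (+-cancelʳ-≡ 3 t (1 + k) (trans e (cong suc (trans n≡3+k (+-comm 3 k))))) Vt≡3))
      ...   | inj₂ (inj₂ e) = contradiction (+-cancelʳ-≡ 3 t n (trans e (+-comm 3 n))) (<⇒≢ t<n)
      target₂ : (V (2 + k) ≡ᵇ 2) ∨ (V (1 + k) ≡ᵇ 2) ≡ true
      target₂ with onto-B 2 (<-trans (n<1+n 2) 3<n) refl
      ... | t , t<n , t∈A , Vt≡2 with sumOK⇒ t 2 (subst (λ x → sumOK t x ≡ true) Vt≡2 (sum-OK t t<n t∈A))
      ...   | inj₁ e        = ∨-≡trueʳ (V (2 + k) ≡ᵇ 2) (≡⇒≡ᵇ≡true (subst (λ s → V s ≡ 2) (+-cancelʳ-≡ 2 t (1 + k) (trans e (trans n≡3+k (cong suc (+-comm 2 k))))) Vt≡2))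
      ...   | inj₂ (inj₁ e) = ∨-≡trueˡ (V (1 + k) ≡ᵇ 2) (≡⇒≡ᵇ≡true (subst (λ s → V s ≡ 2) (+-cancelʳ-≡ 2 t (2 + k) (trans e (cong suc (trans n≡3+k (cong suc (+-comm 2 k)))))) Vt≡2))
      ...   | inj₂ (inj₂ e) = contradiction (+-cancelʳ-≡ 2 t (1 + n) (trans e (cong suc (+-comm 2 n)))) (<⇒≢ (<-trans t<n (n<1+n n)))

  matching⇒allChecks : ∀ {V} → Matching V → AllChecks V
  matching⇒allChecks {V} M = FromMatching.checkAt-holds {V} M , FromMatching.final-holds {V} M

  padded-≥3 : ∀ V i → 3 ≤ i → padded V i ≡ V (i ∸ 3)
  padded-≥3 V (suc (suc (suc i))) _ = refl
  padded-≥3 V (suc zero)          (s≤s ())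
  padded-≥3 V (suc (suc zero))    (s≤s (s≤s ()))

  module FromChecks {V : ℕ → ℕ} (checks : AllChecks V) where

    admissible-at : ∀ i → i < n → inAᵇ i ≡ true →
      admissible i (padded V i) (padded V (1 + i)) (padded V (2 + i)) (V i) ≡ true
    admissible-at i i<n i∈A = trans (sym (checkAt-A V i i∈A)) (proj₁ checks i i<n)

    private
      parts : ∀ i → i < n → inAᵇ i ≡ true →
        inBᵇ (V i) ≡ true × sumOK i (V i) ≡ true ×
        fresh i (padded V i) (padded V (1 + i)) (padded V (2 + i)) (V i) ≡ true × covered i (padded V i) (padded V (1 + i)) (V i) ≡ true
      parts i i<n i∈A = split (admissible-at i i<n i∈A)
        where
        split : ∀ {w x y z} → w ∧ (x ∧ (y ∧ z)) ≡ true → w ≡ true × x ≡ true × y ≡ true × z ≡ true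
        split {true} {true} {true} {true} _ = refl , refl , refl , refl

    to-B : ∀ i → i < n → inAᵇ i ≡ true → inBᵇ (V i) ≡ true
    to-B i i<n i∈A = proj₁ (parts i i<n i∈A)

    sum-OK : ∀ i → i < n → inAᵇ i ≡ true → sumOK i (V i) ≡ true
    sum-OK i i<n i∈A = proj₁ (proj₂ (parts i i<n i∈A))

    fresh-hits : ∀ i → i < n → inAᵇ i ≡ true →
      hits 1 i (padded V (2 + i)) (V i) ≡ false × hits 2 i (padded V (1 + i)) (V i) ≡ false × hits 3 i (padded V i) (V i) ≡ false
    fresh-hits i i<n i∈A = none (proj₁ (proj₂ (proj₂ (parts i i<n i∈A))))
      where
      none : ∀ {h₁ h₂ h₃} → not (h₁ ∨ (h₂ ∨ h₃)) ≡ true → h₁ ≡ false × h₂ ≡ false × h₃ ≡ false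
      none {false} {false} {false} _ = refl , refl , refl

    covered-at : ∀ i → i < n → inAᵇ i ≡ true → covered i (padded V i) (padded V (1 + i)) (V i) ≡ true
    covered-at i i<n i∈A = proj₂ (proj₂ (proj₂ (parts i i<n i∈A)))

    outside-A : ∀ i → i < n → inAᵇ i ≡ false → V i ≡ i
    outside-A i i<n i∉A = ≡ᵇ≡true⇒≡ (trans (sym (checkAt-∉A V i i∉A)) (proj₁ checks i i<n))

    not-hit : ∀ {t x} → inAᵇ t ≡ true → V t ≡ x → inAᵇ t ∧ (V t ≡ᵇ x) ≢ false
    not-hit t∈A Vt≡x hit≡false = contradiction (trans (sym hit≡false) (cong₂ _∧_ t∈A (≡⇒≡ᵇ≡true Vt≡x))) λ ()

    -- Two positions with the same value differ by d′ − d ∈ {1, 2, 3}, where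
    -- t + f(t) = n + d; the later one would then fail its freshness check.
    injective-< : ∀ t t′ → t < t′ → t′ < n → inAᵇ t ≡ true → inAᵇ t′ ≡ true → V t ≡ V t′ → ⊥
    injective-< t t′ t<t′ t′<n t∈A t′∈A Vt≡Vt′
      with sumOK⇒ t (V t′) (subst (λ x → sumOK t x ≡ true) Vt≡Vt′ (sum-OK t (<-trans t<t′ t′<n) t∈A))
         | sumOK⇒ t′ (V t′) (sum-OK t′ t′<n t′∈A)
    ... | inj₁ e        | inj₁ e′        = <⇒≢ t<t′ (+-cancelʳ-≡ _ t t′ (trans e (sym e′)))
    ... | inj₁ e        | inj₂ (inj₁ e′) = hit₁ t′ (+-cancelʳ-≡ (V t′) t′ (1 + t) (trans e′ (cong suc (sym e)))) t′<n t′∈A Vt≡Vt′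
      where
      hit₁ : ∀ t′ → t′ ≡ 1 + t → t′ < n → inAᵇ t′ ≡ true → V t ≡ V t′ → ⊥
      hit₁ .(1 + t) refl t′<n t′∈A Vt≡Vt′ = not-hit t∈A Vt≡Vt′ (proj₁ (fresh-hits (1 + t) t′<n t′∈A))
    ... | inj₁ e        | inj₂ (inj₂ e′) = hit₃ t′ (+-cancelʳ-≡ (V t′) t′ (3 + t) (trans e′ (cong (3 +_) (sym e)))) t′<n t′∈A Vt≡Vt′
      where
      hit₃ : ∀ t′ → t′ ≡ 3 + t → t′ < n → inAᵇ t′ ≡ true → V t ≡ V t′ → ⊥
      hit₃ .(3 + t) refl t′<n t′∈A Vt≡Vt′ = not-hit t∈A Vt≡Vt′ (proj₂ (proj₂ (fresh-hits (3 + t) t′<n t′∈A)))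
    ... | inj₂ (inj₁ e) | inj₁ e′        = <⇒≱ t<t′ (≤-trans (n≤1+n t′) (≤-reflexive (+-cancelʳ-≡ (V t′) (1 + t′) t (trans (cong suc e′) (sym e)))))
    ... | inj₂ (inj₁ e) | inj₂ (inj₁ e′) = <⇒≢ t<t′ (+-cancelʳ-≡ _ t t′ (trans e (sym e′)))
    ... | inj₂ (inj₁ e) | inj₂ (inj₂ e′) = hit₂ t′ (+-cancelʳ-≡ (V t′) t′ (2 + t) (trans e′ (cong (2 +_) (sym e)))) t′<n t′∈A Vt≡Vt′
      where
      hit₂ : ∀ t′ → t′ ≡ 2 + t → t′ < n → inAᵇ t′ ≡ true → V t ≡ V t′ → ⊥
      hit₂ .(2 + t) refl t′<n t′∈A Vt≡Vt′ = not-hit t∈A Vt≡Vt′ (proj₁ (proj₂ (fresh-hits (2 + t) t′<n t′∈A)))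
    ... | inj₂ (inj₂ e) | inj₁ e′        = <⇒≱ t<t′ (≤-trans (m≤n+m t′ 3) (≤-reflexive (+-cancelʳ-≡ (V t′) (3 + t′) t (trans (cong (3 +_) e′) (sym e)))))
    ... | inj₂ (inj₂ e) | inj₂ (inj₁ e′) = <⇒≱ t<t′ (≤-trans (m≤n+m t′ 2) (≤-reflexive (+-cancelʳ-≡ (V t′) (2 + t′) t (trans (cong (2 +_) e′) (sym e)))))
    ... | inj₂ (inj₂ e) | inj₂ (inj₂ e′) = <⇒≢ t<t′ (+-cancelʳ-≡ _ t t′ (trans e (sym e′)))

    injective : ∀ i j → i < n → j < n → inAᵇ i ≡ true → inAᵇ j ≡ true → V i ≡ V j → i ≡ j
    injective i j i<n j<n i∈A j∈A Vi≡Vj with <-cmp i j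
    ... | tri< i<j _ _ = ⊥-elim (injective-< i j i<j j<n i∈A j∈A Vi≡Vj)
    ... | tri≈ _ i≡j _ = i≡j
    ... | tri> _ _ j<i = ⊥-elim (injective-< j i j<i i<n j∈A i∈A (sym Vi≡Vj))

    near-end : ∀ j {b} → j ≤ 2 → V (j + k) ≡ b → ∃ λ t → t < n × inAᵇ t ≡ true × V t ≡ b
    near-end j j≤2 e = j + k , subst (j + k <_) (sym n≡3+k) (+-monoˡ-< k (s≤s j≤2))
                     , inAᵇ-≥4 (j + k) (≤-trans (∸-monoˡ-≤ 3 (≤-trans (m≤n+m 7 3) 10≤n)) (m≤n+m k j)) , e

    -- a target b ≥ 4 is the last chance of position i = n + 3 − b
    onto-B : ∀ b → b < n → inBᵇ b ≡ true → ∃ λ t → t < n × inAᵇ t ≡ true × V t ≡ b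
    onto-B (suc (suc zero)) _ _ with ∨-≡true (proj₂ (∧-≡true (proj₂ checks)))
    ... | inj₁ e = near-end 2 ≤-refl (≡ᵇ≡true⇒≡ e)
    ... | inj₂ e = near-end 1 (s≤s z≤n) (≡ᵇ≡true⇒≡ e)
    onto-B (suc (suc (suc zero))) _ _ with ∨-≡true (proj₁ (∧-≡true (proj₂ checks)))
    ... | inj₁ e = near-end 1 (s≤s z≤n) (≡ᵇ≡true⇒≡ e)
    ... | inj₂ e = near-end 0 z≤n (≡ᵇ≡true⇒≡ e)
    onto-B b@(suc (suc (suc (suc _)))) b<n b∈B = by-hit (∨-≡true hit)
      where
      b≤n+3 : b ≤ n + 3
      b≤n+3 = ≤-trans (<⇒≤ b<n) (m≤m+n n 3)
      i = n + 3 ∸ b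
      i+b≡3+n : i + b ≡ 3 + n
      i+b≡3+n = trans (m∸n+n≡m b≤n+3) (+-comm n 3)
      i<n : i < n
      i<n = +-cancelʳ-< b i n (subst (_< n + b) (trans (+-comm n 3) (sym i+b≡3+n)) (+-monoʳ-< n (s≤s (s≤s (s≤s (s≤s z≤n))))))
      4≤i : 4 ≤ i
      4≤i = +-cancelʳ-≤ b 4 i (subst (4 + b ≤_) (sym i+b≡3+n) (+-monoʳ-≤ 3 b<n))
      hit : coveredBefore i (padded V i) (padded V (1 + i)) b ∨ (V i ≡ᵇ b) ≡ true
      p₃ = padded V i
      p₂ = padded V (1 + i)
      hit = trans (sym (trans (cong₂ (λ t c → not t ∨ coveredAt i p₃ p₂ (V i) c) (Equivalence.to T-≡ (≤⇒≤ᵇ 4≤i)) (m∸[m∸n]≡n b≤n+3))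
                              (cong (λ t → (not t ∨ coveredBefore i p₃ p₂ b) ∨ (V i ≡ᵇ b)) b∈B)))
                  (covered-at i i<n (inAᵇ-≥4 i 4≤i))
      by-hit : coveredBefore i p₃ p₂ b ≡ true ⊎ (V i ≡ᵇ b) ≡ true → ∃ λ t → t < n × inAᵇ t ≡ true × V t ≡ b
      by-hit (inj₂ e) = i , i<n , inAᵇ-≥4 i 4≤i , ≡ᵇ≡true⇒≡ e
      by-hit (inj₁ cb) with ∨-≡true cb
      ... | inj₁ h₂ = i ∸ 2 , ≤-<-trans (m∸n≤m i 2) i<n , proj₁ (∧-≡true h₂)
                    , trans (sym (padded-≥3 V (1 + i) (≤-trans (n≤1+n 3) (≤-trans 4≤i (n≤1+n i))))) (≡ᵇ≡true⇒≡ (proj₂ (∧-≡true h₂)))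
      ... | inj₂ h₃ = i ∸ 3 , ≤-<-trans (m∸n≤m i 3) i<n , proj₁ (∧-≡true h₃)
                    , trans (sym (padded-≥3 V i (≤-trans (n≤1+n 3) 4≤i))) (≡ᵇ≡true⇒≡ (proj₂ (∧-≡true h₃)))

  allChecks⇒matching : ∀ {V} → AllChecks V → Matching V
  allChecks⇒matching {V} checks = record
    { to-B = to-B ; sum-OK = sum-OK ; injective = injective ; onto-B = onto-B ; outside-A = outside-A }
    where open FromChecks {V} checks

module Acceptance (n : ℕ) ⦃ _ : NonZero n ⦄ where
  open Automaton n
  open Values n

  passes : ℕ → ℕ → ℕ → ℕ → ∀ {m} → Vec (Fin n) m → Bool
  passes a p₃ p₂ p₁ []ᵥ       = finalCheck p₃ p₂ p₁
  passes a p₃ p₂ p₁ (x ∷ᵥ u) = localCheck a p₃ p₂ p₁ (toℕ x) ∧ passes (suc a) p₂ p₁ (toℕ x) u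

  weightCount : ℕ → ℕ → ∀ {m} → Vec (Fin n) m → ℕ
  weightCount d a []ᵥ       = 0
  weightCount d a (x ∷ᵥ u) = (if inAᵇ a ∧ (a + toℕ x ∸ n ≡ᵇ d) then 1 else 0) + weightCount d (suc a) u

  hasWeightsᵇ : ℕ → ∀ {m} → Vec (Fin n) m → Indicator
  hasWeightsᵇ a u w₀ w₁ w₃ = (weightCount 0 a u ≡ᵇ w₀) ∧ (weightCount 1 a u ≡ᵇ w₁) ∧ (weightCount 3 a u ≡ᵇ w₃)

  accepts≡passes∧weights : ∀ a p₃ p₂ p₁ {m} (u : Vec (Fin n) m) w₀ w₁ w₃ →
    accepts a p₃ p₂ p₁ u w₀ w₁ w₃ ≡ passes a p₃ p₂ p₁ u ∧ hasWeightsᵇ a u w₀ w₁ w₃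
  accepts≡passes∧weights a p₃ p₂ p₁ []ᵥ w₀ w₁ w₃ = cong (finalCheck p₃ p₂ p₁ ∧_) (1ᵇ≡ w₀ w₁ w₃)
    where
    1ᵇ≡ : ∀ w₀ w₁ w₃ → 1ᵇ w₀ w₁ w₃ ≡ (0 ≡ᵇ w₀) ∧ (0 ≡ᵇ w₁) ∧ (0 ≡ᵇ w₃)
    1ᵇ≡ zero    zero    zero    = refl
    1ᵇ≡ zero    zero    (suc _) = refl
    1ᵇ≡ zero    (suc _) _       = refl
    1ᵇ≡ (suc _) _       _       = refl
  accepts≡passes∧weights a p₃ p₂ p₁ (x ∷ᵥ u) w₀ w₁ w₃ =
    guarded (localCheck a p₃ p₂ p₁ (toℕ x)) (λ ok → weighed (inAᵇ a) (a + toℕ x ∸ n) (weight-values ok) w₀ w₁ w₃)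
    where
    F = accepts (suc a) p₂ p₁ (toℕ x) u
    P = passes (suc a) p₂ p₁ (toℕ x) u
    wc : ℕ → ℕ
    wc d = weightCount d (suc a) u
    IH = accepts≡passes∧weights (suc a) p₂ p₁ (toℕ x) u

    guarded : ∀ c {z p w} → (c ≡ true → z ≡ p ∧ w) → c ∧ z ≡ (c ∧ p) ∧ w
    guarded true  z≡ = z≡ refl
    guarded false _  = refl

    weight-values : localCheck a p₃ p₂ p₁ (toℕ x) ≡ true → inAᵇ a ≡ true →
      a + toℕ x ∸ n ≡ 0 ⊎ a + toℕ x ∸ n ≡ 1 ⊎ a + toℕ x ∸ n ≡ 3
    weight-values ok a∈A with sumOK⇒ a (toℕ x) (admissible⇒sumOK a p₃ p₂ p₁ (toℕ x)
                                 (trans (sym (cong (λ i → if i then admissible a p₃ p₂ p₁ (toℕ x) else (toℕ x ≡ᵇ a)) a∈A)) ok))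
    ... | inj₁ e        = inj₁ (trans (cong (_∸ n) e) (n∸n≡0 n))
    ... | inj₂ (inj₁ e) = inj₂ (inj₁ (trans (cong (_∸ n) e) (m+n∸n≡m 1 n)))
    ... | inj₂ (inj₂ e) = inj₂ (inj₂ (trans (cong (_∸ n) e) (m+n∸n≡m 3 n)))

    weighed : ∀ i d → (i ≡ true → d ≡ 0 ⊎ d ≡ 1 ⊎ d ≡ 3) → ∀ w₀ w₁ w₃ →
      (if i then shiftBy false d F else F) w₀ w₁ w₃ ≡
      P ∧ (((if i ∧ (d ≡ᵇ 0) then 1 else 0) + wc 0 ≡ᵇ w₀) ∧ ((if i ∧ (d ≡ᵇ 1) then 1 else 0) + wc 1 ≡ᵇ w₁)
                                                          ∧ ((if i ∧ (d ≡ᵇ 3) then 1 else 0) + wc 3 ≡ᵇ w₃))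
    weighed false d _ w₀ w₁ w₃ = IH w₀ w₁ w₃
    weighed true  d d∈ w₀ w₁ w₃ with d∈ refl
    weighed true  .0 _ zero     w₁ w₃ | inj₁ refl        = sym (∧-zeroʳ P)
    weighed true  .0 _ (suc w₀) w₁ w₃ | inj₁ refl        = IH w₀ w₁ w₃
    weighed true  .1 _ w₀ zero     w₃ | inj₂ (inj₁ refl) = sym (trans (cong (P ∧_) (∧-zeroʳ (wc 0 ≡ᵇ w₀))) (∧-zeroʳ P))
    weighed true  .1 _ w₀ (suc w₁) w₃ | inj₂ (inj₁ refl) = IH w₀ w₁ w₃
    weighed true  .3 _ w₀ w₁ zero     | inj₂ (inj₂ refl) =
      sym (trans (cong (λ z → P ∧ ((wc 0 ≡ᵇ w₀) ∧ z)) (∧-zeroʳ (wc 1 ≡ᵇ w₁))) (trans (cong (P ∧_) (∧-zeroʳ (wc 0 ≡ᵇ w₀))) (∧-zeroʳ P)))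
    weighed true  .3 _ w₀ w₁ (suc w₃) | inj₂ (inj₂ refl) = IH w₀ w₁ w₃

  trace : ℕ → ℕ → ℕ → ∀ {m} → Vec (Fin n) m → ℕ → ℕ
  trace p₃ p₂ p₁ u = prefixed p₃ p₂ p₁ (value u)

  checkFrom : ℕ → ℕ → ℕ → ℕ → ∀ {m} → Vec (Fin n) m → ℕ → Bool
  checkFrom a p₃ p₂ p₁ u i = localCheck (i + a) (t i) (t (1 + i)) (t (2 + i)) (t (3 + i))
    where t = trace p₃ p₂ p₁ u

  Checks : ℕ → ℕ → ℕ → ℕ → ∀ {m} → Vec (Fin n) m → Set
  Checks a p₃ p₂ p₁ {m} u = (∀ i → i < m → checkFrom a p₃ p₂ p₁ u i ≡ true)
                          × finalCheck (trace p₃ p₂ p₁ u m) (trace p₃ p₂ p₁ u (1 + m)) (trace p₃ p₂ p₁ u (2 + m)) ≡ true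

  trace-∷ : ∀ p₃ p₂ p₁ {m} x (u : Vec (Fin n) m) i → trace p₃ p₂ p₁ (x ∷ᵥ u) (suc i) ≡ trace p₂ p₁ (toℕ x) u i
  trace-∷ p₃ p₂ p₁ x u 0                   = refl
  trace-∷ p₃ p₂ p₁ x u 1                   = refl
  trace-∷ p₃ p₂ p₁ x u 2                   = refl
  trace-∷ p₃ p₂ p₁ x u (suc (suc (suc i))) = refl

  checkFrom-∷ : ∀ a p₃ p₂ p₁ {m} x (u : Vec (Fin n) m) i →
    checkFrom a p₃ p₂ p₁ (x ∷ᵥ u) (suc i) ≡ checkFrom (suc a) p₂ p₁ (toℕ x) u i
  checkFrom-∷ a p₃ p₂ p₁ x u 0                   = refl
  checkFrom-∷ a p₃ p₂ p₁ x u 1                   = refl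
  checkFrom-∷ a p₃ p₂ p₁ x u 2                   = refl
  checkFrom-∷ a p₃ p₂ p₁ x u (suc (suc (suc j))) =
    cong (λ b → localCheck (3 + b) (value u j) (value u (1 + j)) (value u (2 + j)) (value u (3 + j))) (sym (+-suc j a))

  finalCheck-∷ : ∀ p₃ p₂ p₁ {m} x (u : Vec (Fin n) m) →
    finalCheck (trace p₃ p₂ p₁ (x ∷ᵥ u) (suc m)) (trace p₃ p₂ p₁ (x ∷ᵥ u) (2 + m)) (trace p₃ p₂ p₁ (x ∷ᵥ u) (3 + m))
      ≡ finalCheck (trace p₂ p₁ (toℕ x) u m) (trace p₂ p₁ (toℕ x) u (1 + m)) (trace p₂ p₁ (toℕ x) u (2 + m))
  finalCheck-∷ p₃ p₂ p₁ {m} x u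
    rewrite trace-∷ p₃ p₂ p₁ x u m | trace-∷ p₃ p₂ p₁ x u (1 + m) | trace-∷ p₃ p₂ p₁ x u (2 + m) = refl

  passes⇒ : ∀ a p₃ p₂ p₁ {m} (u : Vec (Fin n) m) → passes a p₃ p₂ p₁ u ≡ true → Checks a p₃ p₂ p₁ u
  passes⇒ a p₃ p₂ p₁ []ᵥ       ok = (λ _ ()) , ok
  passes⇒ a p₃ p₂ p₁ (x ∷ᵥ u) ok with ∧-≡true ok
  ... | here , rest with passes⇒ (suc a) p₂ p₁ (toℕ x) u rest
  ...   | later , final = all , trans (finalCheck-∷ p₃ p₂ p₁ x u) final
    where
    all : ∀ i → i < suc _ → checkFrom a p₃ p₂ p₁ (x ∷ᵥ u) i ≡ true
    all zero    _         = here
    all (suc i) (s≤s i<m) = trans (checkFrom-∷ a p₃ p₂ p₁ x u i) (later i i<m)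

  ⇒passes : ∀ a p₃ p₂ p₁ {m} (u : Vec (Fin n) m) → Checks a p₃ p₂ p₁ u → passes a p₃ p₂ p₁ u ≡ true
  ⇒passes a p₃ p₂ p₁ []ᵥ       (_ , final) = final
  ⇒passes a p₃ p₂ p₁ (x ∷ᵥ u) (all , final) = cong₂ _∧_ (all 0 z<s)
    (⇒passes (suc a) p₂ p₁ (toℕ x) u
      ((λ i i<m → trans (sym (checkFrom-∷ a p₃ p₂ p₁ x u i)) (all (suc i) (s<s i<m))) , trans (sym (finalCheck-∷ p₃ p₂ p₁ x u)) final))

  weightCount-sum : ∀ d a {m} (u : Vec (Fin n) m) →
    weightCount d a u ≡ sumBelow (λ i → if inAᵇ (i + a) ∧ (i + a + value u i ∸ n ≡ᵇ d) then 1 else 0) m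
  weightCount-sum d a []ᵥ       = refl
  weightCount-sum d a {suc m} (x ∷ᵥ u) = cong (_ +_) (trans (weightCount-sum d (suc a) u)
    (sumBelow-cong m (λ i _ → cong (λ b → if inAᵇ b ∧ (b + value u i ∸ n ≡ᵇ d) then 1 else 0) (+-suc i a))))

module Counting (n : ℕ) ⦃ _ : NonZero n ⦄ (10≤n : 10 ≤ n) where
  open Automaton n
  open Values n
  open Translation n (≤-trans (m≤m+n 7 3) 10≤n)
  open LocalChecks n 10≤n
  open Acceptance n

  private
    final-at-k : ∀ (v : Vec (Fin n) n) → finalCheck (trace 0 0 0 v n) (trace 0 0 0 v (1 + n)) (trace 0 0 0 v (2 + n))
                     ≡ finalCheck (value v k) (value v (1 + k)) (value v (2 + k))
    final-at-k v = cong (λ m → finalCheck (trace 0 0 0 v m) (trace 0 0 0 v (1 + m)) (trace 0 0 0 v (2 + m))) n≡3+k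

    check-at-0 : ∀ (v : Vec (Fin n) n) i → checkFrom 0 0 0 0 v i ≡ checkAt (value v) i
    check-at-0 v i = cong (λ b → localCheck b (padded V i) (padded V (1 + i)) (padded V (2 + i)) (V i)) (+-identityʳ i)
      where V = value v

  passes⇒AllChecks : ∀ (v : Vec (Fin n) n) → passes 0 0 0 0 v ≡ true → AllChecks (value v)
  passes⇒AllChecks v ok with passes⇒ 0 0 0 0 v ok
  ... | all , final = (λ i i<n → trans (sym (check-at-0 v i)) (all i i<n)) , trans (sym (final-at-k v)) final

  AllChecks⇒passes : ∀ (v : Vec (Fin n) n) → AllChecks (value v) → passes 0 0 0 0 v ≡ true
  AllChecks⇒passes v (all , final) = ⇒passes 0 0 0 0 v ((λ i i<n → trans (check-at-0 v i) (all i i<n)) , trans (final-at-k v) final)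

  weight≡weightCount : ∀ (v : Vec (Fin n) n) → Matching (value v) → ∀ d → d < 7 → weight n ([_] n d) v ≡ weightCount d 0 v
  weight≡weightCount v M d d<7 = begin
    weight n ([_] n d) v
      ≡⟨ length-filter≡count _ (allFin n) ⟩
    count (λ a → does (inA? n a ×-dec (_⊕_ n a (lookup v a) ≟ᶠ [_] n d))) (allFin n)
      ≡⟨ count-cong test (allFin n) ⟩
    count (λ a → g (toℕ a)) (allFin n)
      ≡⟨ count≡sum _ (allFin n) ⟩
    sum (map (λ a → if g (toℕ a) then 1 else 0) (allFin n))
      ≡⟨ sum-allFin n (λ t → if g t then 1 else 0) ⟩
    sumBelow (λ t → if g t then 1 else 0) n
      ≡⟨ sumBelow-cong n wrap ⟩
    sumBelow (λ t → if inAᵇ (t + 0) ∧ (t + 0 + V t ∸ n ≡ᵇ d) then 1 else 0) n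
      ≡⟨ weightCount-sum d 0 v ⟨
    weightCount d 0 v ∎
    where
    open ≡-Reasoning
    open Matching M
    V = value v
    g : ℕ → Bool
    g t = inAᵇ t ∧ ((t + V t) % n ≡ᵇ d)
    test : ∀ a → does (inA? n a ×-dec (_⊕_ n a (lookup v a) ≟ᶠ [_] n d)) ≡ g (toℕ a)
    test a = cong₂ _∧_ (does-inA? a) (trans (does-≟ᶠ (_⊕_ n a (lookup v a)) ([_] n d)) (cong₂ _≡ᵇ_ (toℕ-⊕ v a) (toℕ-[k]≡k d d<7)))
    wrap : ∀ t → t < n → (if g t then 1 else 0) ≡ (if inAᵇ (t + 0) ∧ (t + 0 + V t ∸ n ≡ᵇ d) then 1 else 0)
    wrap t t<n = trans (by-cases (inAᵇ t) refl) (cong (λ b → if inAᵇ b ∧ (b + V t ∸ n ≡ᵇ d) then 1 else 0) (sym (+-identityʳ t)))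
      where
      by-cases : ∀ b → inAᵇ t ≡ b → (if g t then 1 else 0) ≡ (if inAᵇ t ∧ (t + V t ∸ n ≡ᵇ d) then 1 else 0)
      by-cases false t∉A = trans (cong (λ i → if i ∧ ((t + V t) % n ≡ᵇ d) then 1 else 0) t∉A)
                                 (sym (cong (λ i → if i ∧ (t + V t ∸ n ≡ᵇ d) then 1 else 0) t∉A))
      by-cases true  t∈A = cong (λ s → if inAᵇ t ∧ (s ≡ᵇ d) then 1 else 0) (%-wrap (t + V t) n≤s (+-mono-< t<n (value<n v t t<n)))
        where
        n≤s : n ≤ t + V t
        n≤s with sumOK⇒ t (V t) (sum-OK t t<n t∈A)
        ... | inj₁ e        = ≤-reflexive (sym e)
        ... | inj₂ (inj₁ e) = ≤-trans (n≤1+n n) (≤-reflexive (sym e))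
        ... | inj₂ (inj₂ e) = ≤-trans (m≤n+m n 3) (≤-reflexive (sym e))

  does≡accepts : ∀ (v : Vec (Fin n) n) w₀ w₁ w₃ →
    does (isMatching? n v ×-dec hasWeights? n w₀ w₁ w₃ v) ≡ accepts 0 0 0 0 v w₀ w₁ w₃
  does≡accepts v w₀ w₁ w₃ = does≡ (isMatching? n v ×-dec hasWeights? n w₀ w₁ w₃ v) _ ⇒accepts accepts⇒
    where
    small : ∀ {d} → d ≡ 0 ⊎ d ≡ 1 ⊎ d ≡ 3 → d < 7
    small (inj₁ refl)        = s≤s z≤n
    small (inj₂ (inj₁ refl)) = s≤s (s≤s z≤n)
    small (inj₂ (inj₂ refl)) = s≤s (s≤s (s≤s (s≤s z≤n)))

    ⇒accepts : IsMatching n v × HasWeights n w₀ w₁ w₃ v → accepts 0 0 0 0 v w₀ w₁ w₃ ≡ true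
    ⇒accepts (matching , h₀ , h₁ , h₃) =
      trans (accepts≡passes∧weights 0 0 0 0 v w₀ w₁ w₃)
            (cong₂ _∧_ (AllChecks⇒passes v (matching⇒allChecks M))
                       (cong₂ _∧_ (counted (inj₁ refl) h₀) (cong₂ _∧_ (counted (inj₂ (inj₁ refl)) h₁) (counted (inj₂ (inj₂ refl)) h₃))))
      where
      M = isMatching⇒ v matching
      counted : ∀ {d w} → d ≡ 0 ⊎ d ≡ 1 ⊎ d ≡ 3 → weight n ([_] n d) v ≡ w → (weightCount d 0 v ≡ᵇ w) ≡ true
      counted d∈ e = ≡⇒≡ᵇ≡true (trans (sym (weight≡weightCount v M _ (small d∈))) e)

    accepts⇒ : accepts 0 0 0 0 v w₀ w₁ w₃ ≡ true → IsMatching n v × HasWeights n w₀ w₁ w₃ v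
    accepts⇒ ok with ∧-≡true (trans (sym (accepts≡passes∧weights 0 0 0 0 v w₀ w₁ w₃)) ok)
    ... | passes-ok , weights-ok with ∧-≡true weights-ok
    ...   | w₀-ok , weights-ok′ with ∧-≡true weights-ok′
    ...     | w₁-ok , w₃-ok =
      ⇒isMatching v M , counted (inj₁ refl) w₀-ok , counted (inj₂ (inj₁ refl)) w₁-ok , counted (inj₂ (inj₂ refl)) w₃-ok
      where
      M = allChecks⇒matching (passes⇒AllChecks v passes-ok)
      counted : ∀ {d w} → d ≡ 0 ⊎ d ≡ 1 ⊎ d ≡ 3 → (weightCount d 0 v ≡ᵇ w) ≡ true → weight n ([_] n d) v ≡ w
      counted d∈ e = trans (weight≡weightCount v M _ (small d∈)) (≡ᵇ≡true⇒≡ e)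

  matchingGF≡countAccepted : ∀ w₀ w₁ w₃ → matchingGF n w₀ w₁ w₃ ≡ countAccepted 0 0 0 0 n w₀ w₁ w₃
  matchingGF≡countAccepted w₀ w₁ w₃ =
    trans (length-filter≡count _ (allVecs n n)) (count-cong (λ v → does≡accepts v w₀ w₁ w₃) (allVecs n n))

open import Data.Integer using (+_)

P≡P′ : ∀ {x k} → k ≤ x → x P k ≡ x P′ k
P≡P′ {x} {k} k≤x with k ≤ᵇ x | ≤⇒≤ᵇ k≤x
... | true | _ = refl

P-suc : ∀ x k → suc x P suc k ≡ suc x * (x P k)
P-suc x k with k ≤? x
... | yes k≤x = begin
  suc x P suc k        ≡⟨ P≡P′ (s≤s k≤x) ⟩
  suc x P′ suc k       ≡⟨ nP′k≡n[n∸1P′k∸1] (suc x) (suc k) ⟩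
  suc x * (x P′ k)     ≡⟨ cong (suc x *_) (P≡P′ k≤x) ⟨
  suc x * (x P k)      ∎
  where open ≡-Reasoning
... | no k≰x = begin
  suc x P suc k        ≡⟨ k>n⇒nPk≡0 (s≤s (≰⇒> k≰x)) ⟩
  0                    ≡⟨ *-zeroʳ (suc x) ⟨
  suc x * 0            ≡⟨ cong (suc x *_) (k>n⇒nPk≡0 (≰⇒> k≰x)) ⟨
  suc x * (x P k)      ∎
  where open ≡-Reasoning

falling-ℕ : ∀ x k → falling (+ x) k ≡ + (x P k)
falling-ℕ x       zero    = refl
falling-ℕ zero    (suc k) = refl
falling-ℕ (suc x) (suc k) = begin
  + suc x ℤ.* falling (+ x) k ≡⟨ cong (+ suc x ℤ.*_) (falling-ℕ x k) ⟩
  + suc x ℤ.* + (x P k)       ≡⟨ ℤ.pos-* (suc x) (x P k) ⟨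
  + (suc x * (x P k))         ≡⟨ cong +_ (P-suc x k) ⟨
  + (suc x P suc k)           ∎
  where open ≡-Reasoning

binom-ℕ : ∀ x k → binom (+ x) (+ k) ≡ + (x C k)
binom-ℕ x k = begin
  (falling (+ x) k ℤ./ + (k !)) {{k !≢0}}  ≡⟨ cong (λ z → (z ℤ./ + (k !)) {{k !≢0}}) (falling-ℕ x k) ⟩
  (+ (x P k) ℤ./ + (k !)) {{k !≢0}}        ≡⟨ div-pos-is-/ℕ (+ (x P k)) (k !) {{k !≢0}} ⟩
  + (((x P k) / (k !)) {{k !≢0}})              ≡⟨ cong +_ (P/!≡C (k ≤? x)) ⟩
  + (x C k)                                ∎
  where
  open ≡-Reasoning
  P/!≡C : Dec (k ≤ x) → ((x P k) / (k !)) {{k !≢0}} ≡ x C k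
  P/!≡C (yes k≤x) = sym (nCk≡nPk/k! k≤x)
  P/!≡C (no  k≰x) = begin
    ((x P k) / (k !)) {{k !≢0}} ≡⟨ cong (λ z → (z / (k !)) {{k !≢0}}) (k>n⇒nPk≡0 (≰⇒> k≰x)) ⟩
    (0 / (k !)) {{k !≢0}}     ≡⟨ 0/n≡0 (k !) {{k !≢0}} ⟩
    0                       ≡⟨ k>n⇒nCk≡0 (≰⇒> k≰x) ⟨
    x C k                   ∎

+-‿-≡∸ : ∀ s k → k ≤ s → + s ℤ.- + k ≡ + (s ∸ k)
+-‿-≡∸ s k k≤s = trans (ℤ.[+m]-[+n]≡m⊖n s k) (ℤ.⊖-≥ k≤s)

term₁-ℤ : ∀ a b → 2 ≤ a + b → + term₁ a b ≡ binom (+ a ℤ.+ + b ℤ.- + 2) (+ b)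
term₁-ℤ a b 2≤a+b = sym (trans (cong (λ z → binom z (+ b)) (+-‿-≡∸ (a + b) 2 2≤a+b)) (binom-ℕ _ b))

term₂-ℤ : ∀ a b → 3 ≤ a + b → + term₂ a b ≡ binom (+ a ℤ.+ + b ℤ.- + 3) (+ b ℤ.- + 1)
term₂-ℤ a zero    _      = refl
term₂-ℤ a (suc b) 3≤a+b = sym (trans (cong (λ z → binom z (+ b)) top) (binom-ℕ _ b))
  where
  top : + (a + suc b) ℤ.- + 3 ≡ + (a + b ∸ 2)
  top = trans (+-‿-≡∸ (a + suc b) 3 3≤a+b) (cong (λ s → + (s ∸ 3)) (+-suc a b))

term₃-ℤ : ∀ a b → + term₃ a b ≡ binom (+ a ℤ.+ + b ℤ.- + 3) (+ b ℤ.- + 3)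
term₃-ℤ a zero                = refl
term₃-ℤ a (suc zero)          = refl
term₃-ℤ a (suc (suc zero))    = refl
term₃-ℤ a (suc (suc (suc b))) = sym (trans (cong (λ z → binom z (+ b)) top) (binom-ℕ _ b))
  where
  regroup : ∀ a b → a + (3 + b) ≡ 3 + (a + b)
  regroup = solve-∀
  top : + (a + (3 + b)) ℤ.- + 3 ≡ + (a + b)
  top = trans (+-‿-≡∸ (a + (3 + b)) 3 (≤-trans (m≤m+n 3 b) (m≤n+m (3 + b) a)))
              (cong (λ s → + (s ∸ 3)) (regroup a b))

binomialSum-ℤ : ∀ a b → 3 ≤ a + b → + binomialSum a b ≡
      binom (+ a ℤ.+ + b ℤ.- + 2) (+ b)
  ℤ.+ binom (+ a ℤ.+ + b ℤ.- + 3) (+ b ℤ.- + 1)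
  ℤ.+ binom (+ a ℤ.+ + b ℤ.- + 3) (+ b ℤ.- + 3)
binomialSum-ℤ a b 3≤a+b = begin
  + (term₁ a b + term₂ a b + term₃ a b)
    ≡⟨ ℤ.pos-+ (term₁ a b + term₂ a b) (term₃ a b) ⟩
  + (term₁ a b + term₂ a b) ℤ.+ + term₃ a b
    ≡⟨ cong (ℤ._+ + term₃ a b) (ℤ.pos-+ (term₁ a b) (term₂ a b)) ⟩
  + term₁ a b ℤ.+ + term₂ a b ℤ.+ + term₃ a b
    ≡⟨ cong₂ ℤ._+_ (cong₂ ℤ._+_ (term₁-ℤ a b (≤-trans (n≤1+n 2) 3≤a+b)) (term₂-ℤ a b 3≤a+b)) (term₃-ℤ a b) ⟩
  _ ∎
  where open ≡-Reasoning

rhsPoly-ℤ : ∀ n a b c → 10 ≤ n → + rhsPoly n a b c ≡ rhsCoeff n a b c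
rhsPoly-ℤ n a b c 10≤n with (a + b + c) ≟ (n ∸ 3) | (2 * a + b + 1) ≟ (c + 6)
... | yes p | yes q = trans (cong +_ (if-true (onSupport n a b c) onS)) (binomialSum-ℤ a b (onSupport⇒3≤a+b n a b c 10≤n onS))
  where
  onS : T (onSupport n a b c)
  onS = Equivalence.from T-∧ (≡⇒≡ᵇ _ _ p , ≡⇒≡ᵇ _ _ q)
... | yes _ | no ¬q = cong +_ (if-false (onSupport n a b c) (¬q ∘ ≡ᵇ⇒≡ _ _ ∘ proj₂ ∘ Equivalence.to T-∧))
... | no ¬p | _     = cong +_ (if-false (onSupport n a b c) (¬p ∘ ≡ᵇ⇒≡ _ _ ∘ proj₁ ∘ Equivalence.to T-∧))

matchingGF≡rhsCoeff : ∀ i w₀ w₁ w₃ → + matchingGF (10 + i) w₀ w₁ w₃ ≡ rhsCoeff (10 + i) w₀ w₁ w₃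
matchingGF≡rhsCoeff i w₀ w₁ w₃ = begin
  + matchingGF (10 + i) w₀ w₁ w₃
    ≡⟨ cong +_ (Counting.matchingGF≡countAccepted (10 + i) (m≤m+n 10 i) w₀ w₁ w₃) ⟩
  + Automaton.countAccepted (10 + i) 0 0 0 0 (10 + i) w₀ w₁ w₃
    ≡⟨ cong +_ (Head.countAccepted≈matchingPoly i w₀ w₁ w₃) ⟩
  + matchingPoly i w₀ w₁ w₃
    ≡⟨ cong +_ (matchingPoly≈rhsPoly i w₀ w₁ w₃) ⟩
  + rhsPoly (10 + i) w₀ w₁ w₃
    ≡⟨ rhsPoly-ℤ (10 + i) w₀ w₁ w₃ (m≤m+n 10 i) ⟩
  rhsCoeff (10 + i) w₀ w₁ w₃ ∎
  where open ≡-Reasoning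

lemma2p5 : (n : ℕ) {{_ : NonZero n}} → 10 ≤ n →
    (w₀ w₁ w₃ : ℕ) → + matchingGF n w₀ w₁ w₃ ≡ rhsCoeff n w₀ w₁ w₃
lemma2p5 n ⦃ nz ⦄ 10≤n = at-offset (n ∸ 10) n (sym (m+[n∸m]≡n 10≤n)) nz
  where
  -- matchingGF ignores its (irrelevant) NonZero instance
  at-offset : ∀ i m → m ≡ 10 + i → (nz : NonZero m) → ∀ w₀ w₁ w₃ → + matchingGF m ⦃ nz ⦄ w₀ w₁ w₃ ≡ rhsCoeff m w₀ w₁ w₃
  at-offset i .(10 + i) refl nz = instance-irrelevant (10 + i) _ nz (matchingGF≡rhsCoeff i)
    where
    instance-irrelevant : ∀ m (nz nz′ : NonZero m) → (∀ w₀ w₁ w₃ → + matchingGF m ⦃ nz ⦄ w₀ w₁ w₃ ≡ rhsCoeff m w₀ w₁ w₃) →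
      ∀ w₀ w₁ w₃ → + matchingGF m ⦃ nz′ ⦄ w₀ w₁ w₃ ≡ rhsCoeff m w₀ w₁ w₃
    instance-irrelevant m nz nz′ h = h
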